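{- Let $\mathcal{A}$ be a finite set with a statistic $D:\mathcal{A}\to 2^{[N-1]}$, and let $n = \lfloor N/2\rfloor$. The following are equivalent: (i) $D$ is sparse, and for every sparse $J\subseteq[N-1]$ the cardinality of $\{a\in\mathcal{A} \mid D(a)\supseteq J\}$ depends only on $|J|$; (ii) $\mathcal{A}$ is symmetric with respect to $D$ and $\mathcal{Q}_{N,D}(\mathcal{A}) = \sum_{k=0}^{n} c_k s_{(N-k,k)}$ for some $c_k\in\mathbb{Z}$. Furthermore, if these hold, then $\mathcal{A}$ is Schur-positive and \[ \mathcal{Q}_{N,D}(\mathcal{A}) = \sum_{k=0}^{n} \bigl|\{a\in\mathcal{A} \mid D(a) = \{1,3,5,\dots,2k-1\}\}\bigr|\, s_{(N-k,k)}. \]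
   Context: For $N \ge 1$ and $J \subseteq [N-1]$, $F_{N,J} = \sum x_{i_1}\cdots x_{i_N}$, summed over $i_1 \le \dots \le i_N$ with $i_j < i_{j+1}$ for all $j \in J$ (fundamental quasisymmetric function). For a finite set $\mathcal{A}$ and $D:\mathcal{A}\to 2^{[N-1]}$, $\mathcal{Q}_{N,D}(\mathcal{A}) = \sum_{a\in\mathcal{A}} F_{N,D(a)}$. $\mathcal{A}$ is symmetric w.r.t. $D$ if this is a symmetric function, and then it expands uniquely as $\sum_{\lambda\vdash N}c_\lambda s_\lambda$ in Schur functions; $\mathcal{A}$ is Schur-positive if all $c_\lambda\in\mathbb{N}_0$. A set $J\subseteq[N-1]$ is sparse if $\{j,j+1\}\not\subseteq J$ for every $1\le j\le N-2$; $D$ is sparse if $D(a)$ is sparse for every $a\in\mathcal{A}$. For $k=0$ the set $\{1,3,\dots,2k-1\}$ is empty. -}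

module Defs where

open import Data.Nat using (ℕ; zero; suc; _∸_; _≤ᵇ_; _<ᵇ_; _≡ᵇ_; _≤_; ⌊_/2⌋; _⊓_)
open import Data.Nat.Properties using (_≟_)
open import Data.Bool using (Bool; true; false; _∧_; if_then_else_; not)
open import Data.Bool.Properties using () renaming (_≟_ to _≟B_)
open import Data.Fin using (Fin; toℕ)
open import Data.Fin.Subset using (Subset; _⊆_; _∈_; ∣_∣)
open import Data.Fin.Subset.Properties using (_⊆?_)
open import Data.Vec using (Vec; []; _∷_; tabulate)
open import Data.Vec.Properties using (≡-dec)
open import Data.List using (List; []; _∷_; [_]; length; map; concatMap; upTo; allFin; filter; filterᵇ; foldr)
open import Data.Bool.ListAction using (all)
open import Data.Nat.ListAction using (sum)
open import Data.List.Relation.Binary.Permutation.Propositional using (_↭_)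
open import Data.Integer using (ℤ; +_) renaming (_+_ to _+ℤ_; _*_ to _*ℤ_)
open import Data.Product using (Σ; _×_; _,_)
open import Data.Empty using (⊥)
open import Relation.Binary.PropositionalEquality using (_≡_)
open import Relation.Unary using (Decidable)
open import Relation.Nullary using (¬_)

-- A subset J of [N-1] = {1,…,N-1} is an element of Subset (N ∸ 1);
-- the index i : Fin (N ∸ 1) stands for the integer toℕ i + 1.
-- A finite set 𝒜 is Fin m; a statistic is D : Fin m → Subset (N ∸ 1).

#[_] : ∀ {m} {P : Fin m → Set} → Decidable P → ℕ
#[_] {m} P? = length (filter P? (allFin m))

Σℤ : List ℤ → ℤ
Σℤ = foldr _+ℤ_ (+ 0)

Sparse : ∀ {n} → Subset n → Set
Sparse {n} J = (i i′ : Fin n) → toℕ i′ ≡ suc (toℕ i) → i ∈ J → i′ ∈ J → ⊥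

SparseStat : ∀ {n m} → (Fin m → Subset n) → Set
SparseStat D = ∀ a → Sparse (D a)

-- the set {1,3,5,…,2k-1} ⊆ [n] (as Subset n); integer j = toℕ i + 1
even? : ℕ → Bool
even? zero = true
even? (suc zero) = false
even? (suc (suc x)) = even? x

odds : (n k : ℕ) → Subset n
odds n k = tabulate (λ i → even? (toℕ i) ∧ (toℕ i <ᵇ 2 Data.Nat.* k))

-- A monomial x_1^{α_1} ⋯ x_k^{α_k} (α a composition of N) of a
-- quasisymmetric function of degree N is indexed by the set
-- K = {α_1, α_1+α_2, …} ⊆ [N-1] of partial sums; comp K recovers α.

compAux : ∀ {n} → ℕ → Vec Bool n → List ℕ
compAux c [] = c ∷ []
compAux c (true ∷ v) = c ∷ compAux 1 v
compAux c (false ∷ v) = compAux (suc c) v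

comp : ∀ {n} → Subset n → List ℕ
comp K = compAux 1 K

-- coefficient of x^{comp K} in F_{N,J}: the unique weakly increasing
-- index sequence has strict ascents exactly at K, so it is 1 iff J ⊆ K.
-- Hence the coefficient of x^{comp K} in 𝒬_{N,D}(𝒜) is:
coefQ : ∀ {n m} → (Fin m → Subset n) → Subset n → ℕ
coefQ D K = #[ (λ a → D a ⊆? K) ]

-- 𝒜 symmetric w.r.t. D: 𝒬_{N,D}(𝒜) (a quasisymmetric function) is a
-- symmetric function, i.e. coefficients of monomials whose exponent
-- compositions are rearrangements of each other agree.
Symmetric : ∀ {n m} → (Fin m → Subset n) → Set
Symmetric {n} D = (K K′ : Subset n) → comp K ↭ comp K′ → coefQ D K ≡ coefQ D K′

-- Schur functions via semistandard Young tableaux.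
-- A partition is a weakly decreasing list of positive row lengths.
-- A filling of shape λ with entries in {1..k} is a list of rows.

words : ℕ → ℕ → List (List ℕ)
words k zero = [ [] ]
words k (suc r) = concatMap (λ x → map (x ∷_) (words k r)) (map suc (upTo k))

fillings : ℕ → List ℕ → List (List (List ℕ))
fillings k [] = [ [] ]
fillings k (r ∷ λs) = concatMap (λ row → map (row ∷_) (fillings k λs)) (words k r)

weakInc : List ℕ → Bool
weakInc [] = true
weakInc (x ∷ []) = true
weakInc (x ∷ y ∷ r) = (x ≤ᵇ y) ∧ weakInc (y ∷ r)

strictCols : List ℕ → List ℕ → Bool
strictCols _ [] = true
strictCols [] (_ ∷ _) = false
strictCols (x ∷ u) (y ∷ l) = (x <ᵇ y) ∧ strictCols u l

colsOK : List (List ℕ) → Bool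
colsOK [] = true
colsOK (r ∷ []) = true
colsOK (r ∷ r′ ∷ T) = strictCols r r′ ∧ colsOK (r′ ∷ T)

isSSYT : List (List ℕ) → Bool
isSSYT T = all weakInc T ∧ colsOK T

occurrences : ℕ → List (List ℕ) → ℕ
occurrences j T = sum (map (λ row → length (filterᵇ (λ x → x ≡ᵇ j) row)) T)

contentOK : ℕ → List ℕ → List (List ℕ) → Bool
contentOK j [] T = true
contentOK j (a ∷ α) T = (occurrences j T ≡ᵇ a) ∧ contentOK (suc j) α T

kostka : List ℕ → List ℕ → ℕ
kostka λs α = length (filterᵇ (λ T → isSSYT T ∧ contentOK 1 α T) (fillings (length α) λs))

-- all partitions of n with largest part ≤ b (fuel f ≥ n)
partsB : ℕ → ℕ → ℕ → List (List ℕ)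
partsB f zero b = [ [] ]
partsB zero (suc n) b = []
partsB (suc f) (suc n) b =
  concatMap (λ j → map (j ∷_) (partsB f (suc n ∸ j) j)) (map suc (upTo (suc n ⊓ b)))

partitions : ℕ → List (List ℕ)
partitions n = partsB n n n

twoRow : ℕ → ℕ → List ℕ
twoRow N zero = N ∷ []
twoRow N (suc k) = (N ∸ suc k) ∷ suc k ∷ []

-- 𝒬_{N,D}(𝒜) = Σ_{λ ⊢ N} c_λ s_λ, compared coefficientwise on monomials
SchurExpansion : ∀ {n m} → (N : ℕ) → (Fin m → Subset n) → (List ℕ → ℤ) → Set
SchurExpansion {n} N D c = (K : Subset n) →
  + coefQ D K ≡ Σℤ (map (λ λs → c λs *ℤ + kostka λs (comp K)) (partitions N))

SchurPositive : ∀ {n m} → (N : ℕ) → (Fin m → Subset n) → Set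
SchurPositive N D = Symmetric D × Σ (List ℕ → ℕ) (λ c → SchurExpansion N D (λ λs → + c λs))

TwoRowExpansion : ∀ {n m} → (N : ℕ) → (Fin m → Subset n) → (ℕ → ℤ) → Set
TwoRowExpansion {n} N D c = (K : Subset n) →
  + coefQ D K ≡ Σℤ (map (λ k → c k *ℤ + kostka (twoRow N k) (comp K)) (upTo (suc ⌊ N /2⌋)))

CondI : (N m : ℕ) → (Fin m → Subset (N ∸ 1)) → Set
CondI N m D = SparseStat D ×
  ((J J′ : Subset (N ∸ 1)) → Sparse J → Sparse J′ → ∣ J ∣ ≡ ∣ J′ ∣ →
     #[ (λ a → J ⊆? D a) ] ≡ #[ (λ a → J′ ⊆? D a) ])

CondII : (N m : ℕ) → (Fin m → Subset (N ∸ 1)) → Set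
CondII N m D = Symmetric D × Σ (ℕ → ℤ) (λ c → TwoRowExpansion N D c)

oddCount : (N m : ℕ) → (Fin m → Subset (N ∸ 1)) → ℕ → ℕ
oddCount N m D k = #[ (λ a → ≡-dec _≟B_ (D a) (odds (N ∸ 1) k)) ]

{-# OPTIONS --safe #-}
module Submission where

-- Let 𝒜 be the multiset {D a}. The coefficient of x^{comp K} in 𝒬_{N,D}(𝒜) is the
-- number of members of 𝒜 contained in K, and by Möbius inversion these numbers
-- determine 𝒜. Since s_{(N-k,k)} = Σ_T F_{Des T} over the standard tableaux T of shape
-- (N-k,k), an expansion Σₖ cₖ s_{(N-k,k)} with cₖ = cₖ⁺ − cₖ⁻ says that 𝒜 together with
-- cₖ⁻ copies of the descent sets of these tableaux is the multiset of cₖ⁺ copies of them.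
-- Encoded as ballot paths, these descent sets are sparse, the number of them containing a
-- sparse J depends only on ∣J∣, and exactly one of them is {1,3,…,2k-1}; so (ii) ⇒ (i).
-- Conversely, under (i), 𝒜 and the multiset with cₖ = |{a | D a = {1,3,…,2k-1}}| share
-- these properties, and a downward induction on ∣J∣ over sparse J shows they are equal.
-- Hence 𝒬 = Σₖ cₖ s_{(N-k,k)}, which is symmetric because the two-row Kostka number
-- K_{(N-k,k),α} = [q^k] (1 − q) ∏ᵢ (1 + q + ⋯ + q^{αᵢ}) does not depend on the order of α.

module BooleanComparisons where

  open import Data.Nat using (zero; suc; _≤_; _<_; z≤n; s≤s; _≤ᵇ_; _<ᵇ_; _≡ᵇ_)
  open import Data.Nat.Properties using (<⇒≱)
  open import Data.Bool using (true; false)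
  open import Relation.Binary.PropositionalEquality
  open import Relation.Nullary using (contradiction)

  ≡ᵇ-refl : ∀ n → (n ≡ᵇ n) ≡ true
  ≡ᵇ-refl zero = refl
  ≡ᵇ-refl (suc n) = ≡ᵇ-refl n

  ≡ᵇ-sound : ∀ m n → (m ≡ᵇ n) ≡ true → m ≡ n
  ≡ᵇ-sound zero zero _ = refl
  ≡ᵇ-sound (suc m) (suc n) m≡ᵇn = cong suc (≡ᵇ-sound m n m≡ᵇn)

  ≢⇒≡ᵇ-false : ∀ {m n} → m ≢ n → (m ≡ᵇ n) ≡ false
  ≢⇒≡ᵇ-false {m} {n} m≢n with m ≡ᵇ n in m≡ᵇn
  ... | true = contradiction (≡ᵇ-sound m n m≡ᵇn) m≢n
  ... | false = refl

  ≤ᵇ-sound : ∀ m n → (m ≤ᵇ n) ≡ true → m ≤ n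
  ≤ᵇ-sound zero n _ = z≤n
  ≤ᵇ-sound (suc zero) (suc n) _ = s≤s z≤n
  ≤ᵇ-sound (suc (suc m)) (suc n) m≤ᵇn = s≤s (≤ᵇ-sound (suc m) n m≤ᵇn)

  ≤ᵇ-true : ∀ {m n} → m ≤ n → (m ≤ᵇ n) ≡ true
  ≤ᵇ-true {zero} _ = refl
  ≤ᵇ-true {suc zero} (s≤s _) = refl
  ≤ᵇ-true {suc (suc m)} (s≤s m≤n) = ≤ᵇ-true m≤n

  ≤ᵇ-false : ∀ {m n} → n < m → (m ≤ᵇ n) ≡ false
  ≤ᵇ-false {m} {n} n<m with m ≤ᵇ n in m≤ᵇn
  ... | true = contradiction (≤ᵇ-sound m n m≤ᵇn) (<⇒≱ n<m)
  ... | false = refl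

  <ᵇ-true : ∀ {m n} → m < n → (m <ᵇ n) ≡ true
  <ᵇ-true {zero} {suc n} _ = refl
  <ᵇ-true {suc m} {suc n} (s≤s m<n) = <ᵇ-true m<n

  <ᵇ-false : ∀ {m n} → n ≤ m → (m <ᵇ n) ≡ false
  <ᵇ-false {m} {zero} _ = refl
  <ᵇ-false {suc m} {suc n} (s≤s n≤m) = <ᵇ-false n≤m


module Sums where

  open BooleanComparisons
  open import Data.Nat using (ℕ; zero; suc; _+_; _*_; _≤_; _<_; _≡ᵇ_)
  open import Data.Nat.Properties
  open import Data.Bool using (Bool; true; false; _∧_)
  open import Data.List using (List; []; _∷_; [_]; _++_; map; concatMap; concat; replicate; length; upTo; filter; filterᵇ)
  open import Data.List.Properties using (upTo-∷ʳ)
  open import Data.List.Membership.Propositional using (_∈_)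
  open import Data.List.Relation.Unary.Any using (here; there)
  open import Data.Sum using (_⊎_; inj₁; inj₂)
  open import Function using (_∘_)
  open import Relation.Binary.PropositionalEquality hiding ([_])
  open import Relation.Nullary using (does)
  open import Relation.Unary using (Decidable)
  open import Algebra.Properties.CommutativeSemigroup +-commutativeSemigroup using (interchange)

  ⟦_⟧ : Bool → ℕ
  ⟦ true ⟧ = 1
  ⟦ false ⟧ = 0

  ⟦∧⟧ : ∀ a b → ⟦ a ∧ b ⟧ ≡ ⟦ a ⟧ * ⟦ b ⟧
  ⟦∧⟧ true b = sym (+-identityʳ ⟦ b ⟧)
  ⟦∧⟧ false b = refl

  ⟦⟧*-cong : ∀ b {x y} → (b ≡ true → x ≡ y) → ⟦ b ⟧ * x ≡ ⟦ b ⟧ * y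
  ⟦⟧*-cong true x≡y = cong (_+ 0) (x≡y refl)
  ⟦⟧*-cong false x≡y = refl

  ∑ : ∀ {a} {A : Set a} → List A → (A → ℕ) → ℕ
  ∑ [] f = 0
  ∑ (x ∷ xs) f = f x + ∑ xs f

  module _ {a} {A : Set a} where

    ∑-cong : ∀ (xs : List A) {f g : A → ℕ} → (∀ x → f x ≡ g x) → ∑ xs f ≡ ∑ xs g
    ∑-cong [] f≗g = refl
    ∑-cong (x ∷ xs) f≗g = cong₂ _+_ (f≗g x) (∑-cong xs f≗g)

    ∑-zero : ∀ (xs : List A) {f : A → ℕ} → (∀ x → f x ≡ 0) → ∑ xs f ≡ 0
    ∑-zero [] f≗0 = refl
    ∑-zero (x ∷ xs) f≗0 = cong₂ _+_ (f≗0 x) (∑-zero xs f≗0)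

    ∑-++ : ∀ (xs ys : List A) f → ∑ (xs ++ ys) f ≡ ∑ xs f + ∑ ys f
    ∑-++ [] ys f = refl
    ∑-++ (x ∷ xs) ys f = trans (cong (f x +_) (∑-++ xs ys f)) (sym (+-assoc (f x) _ _))

    ∑-+ : ∀ (xs : List A) f g → ∑ xs (λ x → f x + g x) ≡ ∑ xs f + ∑ xs g
    ∑-+ [] f g = refl
    ∑-+ (x ∷ xs) f g =
      trans (cong (f x + g x +_) (∑-+ xs f g)) (interchange (f x) (g x) (∑ xs f) (∑ xs g))

    ∑-*ˡ : ∀ (xs : List A) c f → ∑ xs (λ x → c * f x) ≡ c * ∑ xs f
    ∑-*ˡ [] c f = sym (*-zeroʳ c)
    ∑-*ˡ (x ∷ xs) c f = trans (cong (c * f x +_) (∑-*ˡ xs c f)) (sym (*-distribˡ-+ c (f x) (∑ xs f)))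

    ∑-*ʳ : ∀ (xs : List A) f c → ∑ xs f * c ≡ ∑ xs (λ x → f x * c)
    ∑-*ʳ xs f c = begin
      ∑ xs f * c           ≡⟨ *-comm (∑ xs f) c ⟩
      c * ∑ xs f           ≡⟨ ∑-*ˡ xs c f ⟨
      ∑ xs (λ x → c * f x) ≡⟨ ∑-cong xs (λ x → *-comm c (f x)) ⟩
      ∑ xs (λ x → f x * c) ∎
      where open ≡-Reasoning

    ∑-concat-replicate : ∀ c (xs : List A) f → ∑ (concat (replicate c xs)) f ≡ c * ∑ xs f
    ∑-concat-replicate zero xs f = refl
    ∑-concat-replicate (suc c) xs f =
      trans (∑-++ xs _ f) (cong (∑ xs f +_) (∑-concat-replicate c xs f))

    ∑-filterᵇ : ∀ (p : A → Bool) xs f → ∑ (filterᵇ p xs) f ≡ ∑ xs (λ x → ⟦ p x ⟧ * f x)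
    ∑-filterᵇ p [] f = refl
    ∑-filterᵇ p (x ∷ xs) f with p x
    ... | true = cong₂ _+_ (sym (+-identityʳ (f x))) (∑-filterᵇ p xs f)
    ... | false = ∑-filterᵇ p xs f

    length-filter : ∀ {P : A → Set} (P? : Decidable P) xs → length (filter P? xs) ≡ ∑ xs (λ x → ⟦ does (P? x) ⟧)
    length-filter P? [] = refl
    length-filter P? (x ∷ xs) with does (P? x)
    ... | true = cong suc (length-filter P? xs)
    ... | false = length-filter P? xs

    ∑-≥ : ∀ {x : A} {xs} f → x ∈ xs → f x ≤ ∑ xs f
    ∑-≥ f (here refl) = m≤m+n _ _
    ∑-≥ {xs = y ∷ ys} f (there x∈ys) = ≤-trans (∑-≥ f x∈ys) (m≤n+m _ (f y))

  module _ {a b} {A : Set a} {B : Set b} where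

    ∑-map : ∀ (g : A → B) xs f → ∑ (map g xs) f ≡ ∑ xs (f ∘ g)
    ∑-map g [] f = refl
    ∑-map g (x ∷ xs) f = cong (f (g x) +_) (∑-map g xs f)

    ∑-concatMap : ∀ (g : A → List B) xs f → ∑ (concatMap g xs) f ≡ ∑ xs (λ x → ∑ (g x) f)
    ∑-concatMap g [] f = refl
    ∑-concatMap g (x ∷ xs) f =
      trans (∑-++ (g x) _ f) (cong (∑ (g x) f +_) (∑-concatMap g xs f))

    ∑-comm : ∀ xs ys (f : A → B → ℕ) → ∑ xs (λ x → ∑ ys (f x)) ≡ ∑ ys (λ y → ∑ xs (λ x → f x y))
    ∑-comm [] ys f = sym (∑-zero ys (λ _ → refl))
    ∑-comm (x ∷ xs) ys f = trans (cong (∑ ys (f x) +_) (∑-comm xs ys f)) (sym (∑-+ ys (f x) _))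

  ∑-upTo-suc : ∀ n (f : ℕ → ℕ) → ∑ (upTo (suc n)) f ≡ ∑ (upTo n) f + f n
  ∑-upTo-suc n f = begin
    ∑ (upTo (suc n)) f       ≡⟨ cong (λ l → ∑ l f) (upTo-∷ʳ n) ⟨
    ∑ (upTo n ++ [ n ]) f    ≡⟨ ∑-++ (upTo n) [ n ] f ⟩
    ∑ (upTo n) f + (f n + 0) ≡⟨ cong (∑ (upTo n) f +_) (+-identityʳ (f n)) ⟩
    ∑ (upTo n) f + f n       ∎
    where open ≡-Reasoning

  ∑-upTo-cong : ∀ n {f g} → (∀ x → x < n → f x ≡ g x) → ∑ (upTo n) f ≡ ∑ (upTo n) g
  ∑-upTo-cong zero f≗g = refl
  ∑-upTo-cong (suc n) {f} {g} f≗g = begin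
    ∑ (upTo (suc n)) f ≡⟨ ∑-upTo-suc n f ⟩
    ∑ (upTo n) f + f n ≡⟨ cong₂ _+_ (∑-upTo-cong n (λ x x<n → f≗g x (m≤n⇒m≤1+n x<n))) (f≗g n ≤-refl) ⟩
    ∑ (upTo n) g + g n ≡⟨ ∑-upTo-suc n g ⟨
    ∑ (upTo (suc n)) g ∎
    where open ≡-Reasoning

  ∑-upTo-pick : ∀ n t (g : ℕ → ℕ) → t < n → ∑ (upTo n) (λ x → ⟦ x ≡ᵇ t ⟧ * g x) ≡ g t
  ∑-upTo-pick (suc n) t g t<1+n = begin
    ∑ (upTo (suc n)) picked    ≡⟨ ∑-upTo-suc n picked ⟩
    ∑ (upTo n) picked + picked n ≡⟨ last (m<1+n⇒m<n∨m≡n t<1+n) ⟩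
    g t                          ∎
    where
    open ≡-Reasoning
    picked : ℕ → ℕ
    picked x = ⟦ x ≡ᵇ t ⟧ * g x
    last : t < n ⊎ t ≡ n → ∑ (upTo n) picked + picked n ≡ g t
    last (inj₁ t<n) rewrite ≢⇒≡ᵇ-false (<⇒≢ t<n ∘ sym) =
      trans (+-identityʳ _) (∑-upTo-pick n t g t<n)
    last (inj₂ refl) rewrite ≡ᵇ-refl t = begin
      ∑ (upTo t) picked + (g t + 0) ≡⟨ cong (_+ (g t + 0)) below ⟩
      g t + 0                       ≡⟨ +-identityʳ (g t) ⟩
      g t                           ∎
      where
      below : ∑ (upTo t) picked ≡ 0
      below = trans (∑-upTo-cong t (λ x x<t → cong (λ b → ⟦ b ⟧ * g x) (≢⇒≡ᵇ-false (<⇒≢ x<t))))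
                    (∑-zero (upTo t) (λ _ → refl))


module BooleanSubsets where

  open import Data.Nat using (zero; suc; _+_; _≤_; _<_; z≤n; s≤s)
  open import Data.Nat.Properties using (m≤n⇒m≤1+n; suc-injective; +-suc)
  open import Data.Bool using (Bool; true; false; _∧_; _∨_; not)
  open import Data.Bool.Properties using () renaming (_≟_ to _≟B_)
  open import Data.Vec using ([]; _∷_; here; there)
  open import Data.Vec.Properties using (≡-dec)
  open import Data.Fin using (zero; suc)
  open import Data.Fin.Subset using (Subset; ∣_∣)
  open import Data.Fin.Subset.Properties using (_⊆?_)
  open import Data.Empty using (⊥-elim)
  open import Relation.Binary.PropositionalEquality
  open import Relation.Nullary using (does)
  open import Defs using (Sparse)

  infix 7 _⊆ᵇ_ _==_

  _⊆ᵇ_ : ∀ {n} → Subset n → Subset n → Bool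
  [] ⊆ᵇ [] = true
  (x ∷ p) ⊆ᵇ (y ∷ q) = (not x ∨ y) ∧ (p ⊆ᵇ q)

  _==_ : ∀ {n} → Subset n → Subset n → Bool
  [] == [] = true
  (x ∷ p) == (y ∷ q) = does (x ≟B y) ∧ (p == q)

  sparseᵇ : ∀ {n} → Subset n → Bool
  sparseᵇ [] = true
  sparseᵇ (x ∷ []) = true
  sparseᵇ (x ∷ y ∷ p) = not (x ∧ y) ∧ sparseᵇ (y ∷ p)

  ⊆?⇔⊆ᵇ : ∀ {n} (p q : Subset n) → does (p ⊆? q) ≡ (p ⊆ᵇ q)
  ⊆?⇔⊆ᵇ [] [] = refl
  ⊆?⇔⊆ᵇ (false ∷ p) (y ∷ q) = ⊆?⇔⊆ᵇ p q
  ⊆?⇔⊆ᵇ (true ∷ p) (false ∷ q) = refl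
  ⊆?⇔⊆ᵇ (true ∷ p) (true ∷ q) = ⊆?⇔⊆ᵇ p q

  ≟⇔== : ∀ {n} (p q : Subset n) → does (≡-dec _≟B_ p q) ≡ (p == q)
  ≟⇔== [] [] = refl
  ≟⇔== (x ∷ p) (y ∷ q) = cong (does (x ≟B y) ∧_) (≟⇔== p q)

  ==⇒≡ : ∀ {n} (p q : Subset n) → (p == q) ≡ true → p ≡ q
  ==⇒≡ [] [] _ = refl
  ==⇒≡ (true ∷ p) (true ∷ q) p==q = cong (true ∷_) (==⇒≡ p q p==q)
  ==⇒≡ (false ∷ p) (false ∷ q) p==q = cong (false ∷_) (==⇒≡ p q p==q)

  ==-refl : ∀ {n} (p : Subset n) → (p == p) ≡ true
  ==-refl [] = refl
  ==-refl (true ∷ p) = ==-refl p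
  ==-refl (false ∷ p) = ==-refl p

  ==-sym-false : ∀ {n} (p q : Subset n) → (p == q) ≡ false → (q == p) ≡ false
  ==-sym-false p q p≠q with q == p in q==p
  ... | true rewrite ==⇒≡ q p q==p | ==-refl p = p≠q
  ... | false = refl

  ⊆ᵇ-refl : ∀ {n} (p : Subset n) → (p ⊆ᵇ p) ≡ true
  ⊆ᵇ-refl [] = refl
  ⊆ᵇ-refl (true ∷ p) = ⊆ᵇ-refl p
  ⊆ᵇ-refl (false ∷ p) = ⊆ᵇ-refl p

  ⊆ᵇ⇒∣∣≤ : ∀ {n} (p q : Subset n) → (p ⊆ᵇ q) ≡ true → ∣ p ∣ ≤ ∣ q ∣
  ⊆ᵇ⇒∣∣≤ [] [] _ = z≤n
  ⊆ᵇ⇒∣∣≤ (false ∷ p) (false ∷ q) p⊆q = ⊆ᵇ⇒∣∣≤ p q p⊆q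
  ⊆ᵇ⇒∣∣≤ (false ∷ p) (true ∷ q) p⊆q = m≤n⇒m≤1+n (⊆ᵇ⇒∣∣≤ p q p⊆q)
  ⊆ᵇ⇒∣∣≤ (true ∷ p) (true ∷ q) p⊆q = s≤s (⊆ᵇ⇒∣∣≤ p q p⊆q)

  ⊂ᵇ⇒∣∣< : ∀ {n} (p q : Subset n) → (p ⊆ᵇ q) ≡ true → (p == q) ≡ false → ∣ p ∣ < ∣ q ∣
  ⊂ᵇ⇒∣∣< [] [] _ ()
  ⊂ᵇ⇒∣∣< (false ∷ p) (false ∷ q) p⊆q p≠q = ⊂ᵇ⇒∣∣< p q p⊆q p≠q
  ⊂ᵇ⇒∣∣< (false ∷ p) (true ∷ q) p⊆q p≠q = s≤s (⊆ᵇ⇒∣∣≤ p q p⊆q)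
  ⊂ᵇ⇒∣∣< (true ∷ p) (true ∷ q) p⊆q p≠q = s≤s (⊂ᵇ⇒∣∣< p q p⊆q p≠q)

  sparseᵇ-tail : ∀ {n} x (p : Subset n) → sparseᵇ (x ∷ p) ≡ true → sparseᵇ p ≡ true
  sparseᵇ-tail x [] _ = refl
  sparseᵇ-tail x (y ∷ p) sp with not (x ∧ y)
  ... | true = sp

  sparseᵇ-false∷ : ∀ {n} (p : Subset n) → sparseᵇ (false ∷ p) ≡ sparseᵇ p
  sparseᵇ-false∷ [] = refl
  sparseᵇ-false∷ (y ∷ p) = refl

  Sparse-tail : ∀ {n} x (p : Subset n) → Sparse (x ∷ p) → Sparse p
  Sparse-tail x p sp i i′ i′≡1+i i∈p i′∈p = sp (suc i) (suc i′) (cong suc i′≡1+i) (there i∈p) (there i′∈p)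

  Sparse⇒sparseᵇ : ∀ {n} (p : Subset n) → Sparse p → sparseᵇ p ≡ true
  Sparse⇒sparseᵇ [] _ = refl
  Sparse⇒sparseᵇ (x ∷ []) _ = refl
  Sparse⇒sparseᵇ (true ∷ true ∷ p) sp = ⊥-elim (sp zero (suc zero) refl here (there here))
  Sparse⇒sparseᵇ (true ∷ false ∷ p) sp = Sparse⇒sparseᵇ (false ∷ p) (Sparse-tail true _ sp)
  Sparse⇒sparseᵇ (false ∷ y ∷ p) sp = Sparse⇒sparseᵇ (y ∷ p) (Sparse-tail false _ sp)

  sparseᵇ⇒Sparse : ∀ {n} (p : Subset n) → sparseᵇ p ≡ true → Sparse p
  sparseᵇ⇒Sparse (true ∷ true ∷ p) () zero (suc zero) refl here (there here)
  sparseᵇ⇒Sparse (true ∷ false ∷ p) sp zero (suc zero) refl here (there ())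
  sparseᵇ⇒Sparse (x ∷ y ∷ p) sp zero (suc (suc i′)) () _ _
  sparseᵇ⇒Sparse (x ∷ p) sp zero zero () _ _
  sparseᵇ⇒Sparse (x ∷ p) sp (suc i) zero () _ _
  sparseᵇ⇒Sparse (x ∷ p) sp (suc i) (suc i′) i′≡1+i (there i∈p) (there i′∈p) =
    sparseᵇ⇒Sparse p (sparseᵇ-tail x p sp) i i′ (suc-injective i′≡1+i) i∈p i′∈p

  sparse⇒∣∣+∣∣≤ : ∀ {n} (p : Subset n) → sparseᵇ p ≡ true → ∣ p ∣ + ∣ p ∣ ≤ suc n
  sparse⇒∣∣+∣∣≤ [] _ = z≤n
  sparse⇒∣∣+∣∣≤ (false ∷ p) sp = m≤n⇒m≤1+n (sparse⇒∣∣+∣∣≤ p (sparseᵇ-tail false p sp))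
  sparse⇒∣∣+∣∣≤ (true ∷ []) _ = s≤s (s≤s z≤n)
  sparse⇒∣∣+∣∣≤ {suc (suc n)} (true ∷ false ∷ p) sp =
    s≤s (subst (_≤ suc (suc n)) (sym (+-suc ∣ p ∣ ∣ p ∣)) (s≤s (sparse⇒∣∣+∣∣≤ p (sparseᵇ-tail false p sp))))


module SubsetMultisets where

  open Sums
  open BooleanSubsets
  open import Data.Nat using (ℕ; zero; suc; _+_; _*_; _≤_; _<_; z≤n; s≤s)
  open import Data.Nat.Properties
  open import Data.Bool using (Bool; true; false; _∧_; not)
  open import Data.Bool.Properties using (∧-identityʳ)
  open import Data.Fin.Subset using (Subset; ∣_∣)
  open import Data.Fin.Subset.Properties using (∣p∣≤n)
  open import Data.List using (List; []; _∷_; _++_; filterᵇ)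
  open import Data.Product using (Σ-syntax; _×_; _,_)
  open import Data.Empty using (⊥-elim)
  open import Relation.Binary.PropositionalEquality

  module _ {n : ℕ} where

    mult : List (Subset n) → Subset n → ℕ
    mult X J = ∑ X (λ x → ⟦ x == J ⟧)

    #⊇ : List (Subset n) → Subset n → ℕ
    #⊇ X J = ∑ X (λ x → ⟦ J ⊆ᵇ x ⟧)

    #⊆ : List (Subset n) → Subset n → ℕ
    #⊆ X K = ∑ X (λ x → ⟦ x ⊆ᵇ K ⟧)

    infix 4 _≈_

    _≈_ : List (Subset n) → List (Subset n) → Set
    X ≈ Y = ∀ J → mult X J ≡ mult Y J

    private
      ∑-insert : ∀ (Y₁ Y₂ : List (Subset n)) x g → ∑ (Y₁ ++ x ∷ Y₂) g ≡ g x + ∑ (Y₁ ++ Y₂) g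
      ∑-insert [] Y₂ x g = refl
      ∑-insert (y ∷ Y₁) Y₂ x g rewrite ∑-insert Y₁ Y₂ x g = x∙yz≈y∙xz (g y) (g x) (∑ (Y₁ ++ Y₂) g)
        where open import Algebra.Properties.CommutativeSemigroup +-commutativeSemigroup using (x∙yz≈y∙xz)

      split : ∀ (Y : List (Subset n)) x → 0 < mult Y x → Σ[ Y₁ ∈ List (Subset n) ] Σ[ Y₂ ∈ List (Subset n) ] Y ≡ Y₁ ++ x ∷ Y₂
      split (y ∷ Y) x x∈Y with y == x in y==x
      ... | true = [] , Y , cong (_∷ Y) (==⇒≡ y x y==x)
      ... | false with split Y x x∈Y
      ... | Y₁ , Y₂ , refl = y ∷ Y₁ , Y₂ , refl

    ≈⇒∑≡ : ∀ X Y → X ≈ Y → ∀ f → ∑ X f ≡ ∑ Y f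
    ≈⇒∑≡ [] [] X≈Y f = refl
    ≈⇒∑≡ [] (y ∷ Y) X≈Y f with X≈Y y
    ... | 0≡mult rewrite ==-refl y = ⊥-elim (0≢1+n 0≡mult)
    ≈⇒∑≡ (x ∷ X) Y X≈Y f with split Y x (subst (0 <_) (X≈Y x) x∈x∷X)
      where
      x∈x∷X : 0 < mult (x ∷ X) x
      x∈x∷X rewrite ==-refl x = s≤s z≤n
    ... | Y₁ , Y₂ , refl = trans (cong (f x +_) (≈⇒∑≡ X (Y₁ ++ Y₂) X≈Y₁Y₂ f)) (sym (∑-insert Y₁ Y₂ x f))
      where
      X≈Y₁Y₂ : X ≈ Y₁ ++ Y₂
      X≈Y₁Y₂ J = +-cancelˡ-≡ ⟦ x == J ⟧ _ _ (trans (X≈Y J) (∑-insert Y₁ Y₂ x (λ z → ⟦ z == J ⟧)))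

    private
      mult-filterᵇ : ∀ (P : Subset n → Bool) Z J → mult (filterᵇ P Z) J ≡ ⟦ P J ⟧ * mult Z J
      mult-filterᵇ P Z J = trans (∑-filterᵇ P Z (λ x → ⟦ x == J ⟧)) (trans (∑-cong Z only-J) (∑-*ˡ Z ⟦ P J ⟧ _))
        where
        only-J : ∀ x → ⟦ P x ⟧ * ⟦ x == J ⟧ ≡ ⟦ P J ⟧ * ⟦ x == J ⟧
        only-J x with x == J in x==J
        ... | true rewrite ==⇒≡ x J x==J = refl
        ... | false = trans (*-zeroʳ ⟦ P x ⟧) (sym (*-zeroʳ ⟦ P J ⟧))

    count-≡-on : ∀ (P : Subset n → Bool) X Y → (∀ J → P J ≡ true → mult X J ≡ mult Y J) →
                 ∑ X (λ x → ⟦ P x ⟧) ≡ ∑ Y (λ x → ⟦ P x ⟧)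
    count-≡-on P X Y agree = begin
      ∑ X (λ x → ⟦ P x ⟧)     ≡⟨ ∑-cong X (λ x → *-identityʳ ⟦ P x ⟧) ⟨
      ∑ X (λ x → ⟦ P x ⟧ * 1) ≡⟨ ∑-filterᵇ P X _ ⟨
      ∑ (filterᵇ P X) _       ≡⟨ ≈⇒∑≡ (filterᵇ P X) (filterᵇ P Y) filtered≈ (λ _ → 1) ⟩
      ∑ (filterᵇ P Y) _       ≡⟨ ∑-filterᵇ P Y _ ⟩
      ∑ Y (λ x → ⟦ P x ⟧ * 1) ≡⟨ ∑-cong Y (λ x → *-identityʳ ⟦ P x ⟧) ⟩
      ∑ Y (λ x → ⟦ P x ⟧)     ∎
      where
      open ≡-Reasoning
      filtered≈ : filterᵇ P X ≈ filterᵇ P Y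
      filtered≈ J rewrite mult-filterᵇ P X J | mult-filterᵇ P Y J with P J in PJ
      ... | true = cong (_+ 0) (agree J PJ)
      ... | false = refl

    #⊂ : List (Subset n) → Subset n → ℕ
    #⊂ X K = ∑ X (λ x → ⟦ x ⊆ᵇ K ∧ not (x == K) ⟧)

    #⊃ : List (Subset n) → Subset n → ℕ
    #⊃ X J = ∑ X (λ x → ⟦ J ⊆ᵇ x ∧ not (x == J) ⟧)

    #⊆≡mult+#⊂ : ∀ X K → #⊆ X K ≡ mult X K + #⊂ X K
    #⊆≡mult+#⊂ X K = trans (∑-cong X split-on-K) (∑-+ X _ _)
      where
      split-on-K : ∀ x → ⟦ x ⊆ᵇ K ⟧ ≡ ⟦ x == K ⟧ + ⟦ x ⊆ᵇ K ∧ not (x == K) ⟧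
      split-on-K x with x == K in x==K
      ... | true rewrite ==⇒≡ x K x==K | ⊆ᵇ-refl K = refl
      ... | false = cong ⟦_⟧ (sym (∧-identityʳ (x ⊆ᵇ K)))

    #⊇≡mult+#⊃ : ∀ X J → #⊇ X J ≡ mult X J + #⊃ X J
    #⊇≡mult+#⊃ X J = trans (∑-cong X split-on-J) (∑-+ X _ _)
      where
      split-on-J : ∀ x → ⟦ J ⊆ᵇ x ⟧ ≡ ⟦ x == J ⟧ + ⟦ J ⊆ᵇ x ∧ not (x == J) ⟧
      split-on-J x with x == J in x==J
      ... | true rewrite ==⇒≡ x J x==J | ⊆ᵇ-refl J = refl
      ... | false = cong ⟦_⟧ (sym (∧-identityʳ (J ⊆ᵇ x)))

    private
      ∧-true : ∀ {a b} → a ∧ b ≡ true → a ≡ true × b ≡ true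
      ∧-true {true} {true} _ = refl , refl

      not-true : ∀ {b} → not b ≡ true → b ≡ false
      not-true {false} _ = refl

    -- Möbius inversion on the Boolean lattice.
    ≈-from-#⊆ : ∀ X Y → (∀ K → #⊆ X K ≡ #⊆ Y K) → X ≈ Y
    ≈-from-#⊆ X Y #⊆-agree K = below (suc ∣ K ∣) K ≤-refl
      where
      below : ∀ t K → ∣ K ∣ < t → mult X K ≡ mult Y K
      below (suc t) K (s≤s ∣K∣≤t) = +-cancelʳ-≡ _ _ _ (begin
        mult X K + #⊂ X K ≡⟨ #⊆≡mult+#⊂ X K ⟨
        #⊆ X K            ≡⟨ #⊆-agree K ⟩
        #⊆ Y K            ≡⟨ #⊆≡mult+#⊂ Y K ⟩
        mult Y K + #⊂ Y K ≡⟨ cong (mult Y K +_) #⊂-agree ⟨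
        mult Y K + #⊂ X K ∎)
        where
        open ≡-Reasoning
        #⊂-agree : #⊂ X K ≡ #⊂ Y K
        #⊂-agree = count-≡-on _ X Y λ J J⊂K →
          let J⊆K , J≢K = ∧-true J⊂K in
          below t J (<-≤-trans (⊂ᵇ⇒∣∣< J K J⊆K (not-true J≢K)) ∣K∣≤t)

    -- Downward induction on ∣ J ∣: the strict supersets of J already agree, so for sparse J
    -- the difference #⊇ X J − #⊇ Y J equals that at the witness O, which is 0.
    ≈-from-sparse-#⊇ : ∀ X Y →
      (∀ J → sparseᵇ J ≡ false → mult X J ≡ mult Y J) →
      (∀ J J′ → sparseᵇ J ≡ true → sparseᵇ J′ ≡ true → ∣ J ∣ ≡ ∣ J′ ∣ →
         #⊇ X J + #⊇ Y J′ ≡ #⊇ X J′ + #⊇ Y J) →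
      (∀ J → sparseᵇ J ≡ true → Σ[ O ∈ Subset n ] sparseᵇ O ≡ true × ∣ O ∣ ≡ ∣ J ∣ × mult X O ≡ mult Y O) →
      X ≈ Y
    ≈-from-sparse-#⊇ X Y non-sparse-agree #⊇-shift witness J = above (suc n) J (m≤n+m (suc n) ∣ J ∣)
      where
      above : ∀ t J → n < ∣ J ∣ + t → mult X J ≡ mult Y J
      above zero J n<∣J∣ = ⊥-elim (<⇒≱ n<∣J∣ (subst (_≤ n) (sym (+-identityʳ ∣ J ∣)) (∣p∣≤n J)))
      above (suc t) J n<∣J∣+1+t = by-sparseness (sparseᵇ J) refl
        where
        #⊃-agree : ∀ J′ → ∣ J′ ∣ ≡ ∣ J ∣ → #⊃ X J′ ≡ #⊃ Y J′
        #⊃-agree J′ ∣J′∣≡∣J∣ = count-≡-on _ X Y λ K J′⊂K →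
          let J′⊆K , K≢J′ = ∧-true J′⊂K
              ∣J′∣<∣K∣ = ⊂ᵇ⇒∣∣< J′ K J′⊆K (==-sym-false K J′ (not-true K≢J′))
              n≤∣J∣+t = ≤-pred (subst (suc n ≤_) (+-suc ∣ J ∣ t) n<∣J∣+1+t)
          in above t K (≤-<-trans n≤∣J∣+t (+-monoˡ-< t (subst (_< ∣ K ∣) ∣J′∣≡∣J∣ ∣J′∣<∣K∣)))
        by-sparseness : ∀ b → sparseᵇ J ≡ b → mult X J ≡ mult Y J
        by-sparseness false J-not-sparse = non-sparse-agree J J-not-sparse
        by-sparseness true J-sparse with witness J J-sparse
        ... | O , O-sparse , ∣O∣≡∣J∣ , mult-O = +-cancelʳ-≡ _ _ _ (begin
          mult X J + #⊃ X J ≡⟨ #⊇≡mult+#⊃ X J ⟨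
          #⊇ X J            ≡⟨ #⊇-J ⟩
          #⊇ Y J            ≡⟨ #⊇≡mult+#⊃ Y J ⟩
          mult Y J + #⊃ Y J ≡⟨ cong (mult Y J +_) (#⊃-agree J refl) ⟨
          mult Y J + #⊃ X J ∎)
          where
          open ≡-Reasoning
          #⊇-O : #⊇ X O ≡ #⊇ Y O
          #⊇-O = trans (#⊇≡mult+#⊃ X O) (trans (cong₂ _+_ mult-O (#⊃-agree O ∣O∣≡∣J∣)) (sym (#⊇≡mult+#⊃ Y O)))
          #⊇-J : #⊇ X J ≡ #⊇ Y J
          #⊇-J = +-cancelʳ-≡ (#⊇ Y O) _ _ (begin
            #⊇ X J + #⊇ Y O ≡⟨ #⊇-shift J O J-sparse O-sparse (sym ∣O∣≡∣J∣) ⟩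
            #⊇ X O + #⊇ Y J ≡⟨ cong (_+ #⊇ Y J) #⊇-O ⟩
            #⊇ Y O + #⊇ Y J ≡⟨ +-comm (#⊇ Y O) (#⊇ Y J) ⟩
            #⊇ Y J + #⊇ Y O ∎)


module IntegerSums where

  open Sums using (∑)
  open import Data.Integer hiding (suc)
  open import Data.Integer.Properties using (+-injective; pos-*; neg-distribˡ-*; +-identityˡ)
  open import Data.Integer.Tactic.RingSolver
  import Data.Nat as ℕ
  import Data.Nat.Properties as ℕ
  open import Data.Nat using (ℕ; suc)
  open import Data.List using (List; []; _∷_; map)
  open import Relation.Binary.PropositionalEquality
  open import Defs using (Σℤ)

  _⁺ : ℤ → ℕ
  (+ n) ⁺ = n
  -[1+ n ] ⁺ = 0

  _⁻ : ℤ → ℕ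
  (+ n) ⁻ = 0
  -[1+ n ] ⁻ = suc n

  module _ {a} {A : Set a} where

    Σℤ-+ : ∀ (xs : List A) (f g : A → ℕ) → Σℤ (map (λ x → + f x * + g x) xs) ≡ + ∑ xs (λ x → f x ℕ.* g x)
    Σℤ-+ [] f g = refl
    Σℤ-+ (x ∷ xs) f g = cong₂ _+_ (sym (pos-* (f x) (g x))) (Σℤ-+ xs f g)

    Σℤ-split : ∀ (xs : List A) (c : A → ℤ) (g : A → ℕ) →
      Σℤ (map (λ x → c x * + g x) xs) ≡ + ∑ xs (λ x → c x ⁺ ℕ.* g x) - + ∑ xs (λ x → c x ⁻ ℕ.* g x)
    Σℤ-split [] c g = refl
    Σℤ-split (x ∷ xs) c g = trans (cong₂ _+_ (split (c x) (g x)) (Σℤ-split xs c g))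
      (regroup (+ (c x ⁺ ℕ.* g x)) (+ ∑ xs (λ x → c x ⁺ ℕ.* g x)) (+ (c x ⁻ ℕ.* g x)) (+ ∑ xs (λ x → c x ⁻ ℕ.* g x)))
      where
      split : ∀ z y → z * + y ≡ + (z ⁺ ℕ.* y) - + (z ⁻ ℕ.* y)
      split (+ n) y = trans (sym (pos-* n y)) (cong +_ (sym (ℕ.+-identityʳ (n ℕ.* y))))
      split -[1+ n ] y = trans (sym (neg-distribˡ-* (+ suc n) (+ y)))
                               (trans (cong -_ (sym (pos-* (suc n) y))) (sym (+-identityˡ _)))
      regroup : ∀ a A b B → (a - b) + (A - B) ≡ (a + A) - (b + B)
      regroup = solve-∀

  +-≡-− : ∀ x y z → + x ≡ + y - + z → x ℕ.+ z ≡ y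
  +-≡-− x y z x≡y-z = +-injective (trans (cong (_+ + z) x≡y-z) (cancel (+ y) (+ z)))
    where
    cancel : ∀ y z → (y - z) + z ≡ y
    cancel = solve-∀


module TwoRowCount where

  open import Data.Nat using (ℕ; zero; suc; _+_; _<_; s≤s)
  open import Data.Nat.Properties using (≤-<-trans; m≤n+m)
  open import Data.List using (List; []; _∷_)
  open import Data.Nat.ListAction using (sum)
  open import Relation.Binary.PropositionalEquality

  δ₀ : ℕ → ℕ
  δ₀ zero = 1
  δ₀ (suc k) = 0

  -- K₂ h k α counts the ways to place the letters 1, 2, … with multiplicities α
  -- into two weakly increasing rows with strictly increasing columns, when the
  -- first row already overhangs the second by h cells and the second row is to
  -- receive exactly k letters. K₂ 0 k α is the Kostka number K_{(N-k,k),α}.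
  -- K₂-place h k a α places a further copies of the current letter: each copy
  -- goes to the first row, or (K₂-place↓, possible only if h > 0) to the second.
  mutual
    K₂ : ℕ → ℕ → List ℕ → ℕ
    K₂ h k [] = δ₀ k
    K₂ h k (a ∷ α) = K₂-place h k a α

    K₂-place : ℕ → ℕ → ℕ → List ℕ → ℕ
    K₂-place h k zero α = K₂ h k α
    K₂-place h k (suc a) α = K₂ (h + suc a) k α + K₂-place↓ h k a α

    K₂-place↓ : ℕ → ℕ → ℕ → List ℕ → ℕ
    K₂-place↓ (suc h) (suc k) a α = K₂-place h k a α
    K₂-place↓ zero k a α = 0
    K₂-place↓ (suc h) zero a α = 0

  K₂-row₁ : ℕ → ℕ → List ℕ → ℕ
  K₂-row₁ h k [] = K₂ h k []
  K₂-row₁ h k (a ∷ α) = K₂ (h + a) k α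

  mutual
    K₂-vanish : ∀ h k α → sum α < k → K₂ h k α ≡ 0
    K₂-vanish h (suc k) [] _ = refl
    K₂-vanish h k (a ∷ α) a+∑α<k = K₂-place-vanish h k a α a+∑α<k

    K₂-place-vanish : ∀ h k a α → a + sum α < k → K₂-place h k a α ≡ 0
    K₂-place-vanish h k zero α ∑α<k = K₂-vanish h k α ∑α<k
    K₂-place-vanish h k (suc a) α 1+a+∑α<k = cong₂ _+_
      (K₂-vanish (h + suc a) k α (≤-<-trans (m≤n+m (sum α) (suc a)) 1+a+∑α<k))
      (K₂-place↓-vanish h k a α 1+a+∑α<k)

    K₂-place↓-vanish : ∀ h k a α → suc a + sum α < k → K₂-place↓ h k a α ≡ 0
    K₂-place↓-vanish (suc h) (suc k) a α (s≤s a+∑α<k) = K₂-place-vanish h k a α a+∑α<k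
    K₂-place↓-vanish zero k a α _ = refl
    K₂-place↓-vanish (suc h) zero a α _ = refl


module TwoRowSymmetry where

  open TwoRowCount
  open import Data.Integer hiding (suc)
  open import Data.Integer.Properties using (+-injective; +-assoc; m-n≡m⊖n; [1+m]⊖[1+n]≡m⊖n; ⊖-<)
  open import Data.Integer.Tactic.RingSolver
  import Data.Nat as ℕ
  import Data.Nat.Properties as ℕ
  open import Data.Nat using (ℕ; zero; suc)
  open import Data.List using (List; []; _∷_)
  open import Data.Nat.ListAction using (sum)
  open import Data.Nat.ListAction.Properties using (sum-↭)
  open import Data.List.Relation.Binary.Permutation.Propositional as ↭ using (_↭_)
  open import Relation.Binary.PropositionalEquality

  δℤ : ℤ → ℤ
  δℤ (+ zero) = + 1
  δℤ (+ suc n) = + 0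
  δℤ -[1+ n ] = + 0

  -- box a f j = f j + f (j - 1) + ⋯ + f (j - a), so boxes α j is the coefficient
  -- of q^j in ∏ᵢ (1 + q + ⋯ + q^{αᵢ}), which does not depend on the order of α.
  box : ℕ → (ℤ → ℤ) → ℤ → ℤ
  box zero f j = f j
  box (suc a) f j = box a f j + f (j - + suc a)

  boxes : List ℕ → ℤ → ℤ
  boxes [] = δℤ
  boxes (a ∷ α) = box a (boxes α)

  VanishesOnNegatives : (ℤ → ℤ) → Set
  VanishesOnNegatives f = ∀ n → f -[1+ n ] ≡ + 0

  box-vanishes : ∀ a f → VanishesOnNegatives f → VanishesOnNegatives (box a f)
  box-vanishes zero f f-vanishes n = f-vanishes n
  box-vanishes (suc a) f f-vanishes n
    rewrite box-vanishes a f f-vanishes n | f-vanishes (suc (n ℕ.+ a)) = refl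

  boxes-vanishes : ∀ α → VanishesOnNegatives (boxes α)
  boxes-vanishes [] n = refl
  boxes-vanishes (a ∷ α) = box-vanishes a (boxes α) (boxes-vanishes α)

  minus-+ : ∀ j x y → j - (x + y) ≡ j - x - y
  minus-+ = solve-∀

  [1+m]-[1+n] : ∀ m n → + suc m - + suc n ≡ + m - + n
  [1+m]-[1+n] m n = trans (m-n≡m⊖n (suc m) (suc n)) (trans ([1+m]⊖[1+n]≡m⊖n m n) (sym (m-n≡m⊖n m n)))

  box-unfoldˡ : ∀ a f j → box (suc a) f j ≡ f j + box a f (j - + 1)
  box-unfoldˡ zero f j = refl
  box-unfoldˡ (suc a) f j = begin
    box (suc a) f j + f (j - + suc (suc a))         ≡⟨ cong₂ _+_ (box-unfoldˡ a f j) (cong f (minus-+ j (+ 1) (+ suc a))) ⟩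
    f j + box a f (j - + 1) + f (j - + 1 - + suc a) ≡⟨ +-assoc (f j) _ _ ⟩
    f j + box (suc a) f (j - + 1)                   ∎
    where open ≡-Reasoning

  box-cong : ∀ a {f g} → (∀ j → f j ≡ g j) → ∀ j → box a f j ≡ box a g j
  box-cong zero f≗g j = f≗g j
  box-cong (suc a) f≗g j = cong₂ _+_ (box-cong a f≗g j) (f≗g _)

  box-distrib-+ : ∀ a f g j → box a (λ i → f i + g i) j ≡ box a f j + box a g j
  box-distrib-+ zero f g j = refl
  box-distrib-+ (suc a) f g j rewrite box-distrib-+ a f g j =
    interchange (box a f j) (box a g j) (f (j - + suc a)) (g (j - + suc a))
    where
    interchange : ∀ w x y z → w + x + (y + z) ≡ w + y + (x + z)
    interchange = solve-∀

  box-shift : ∀ a f c j → box a (λ i → f (i - c)) j ≡ box a f (j - c)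
  box-shift zero f c j = refl
  box-shift (suc a) f c j = cong₂ _+_ (box-shift a f c j) (cong f (minus-comm j (+ suc a) c))
    where
    minus-comm : ∀ j b c → j - b - c ≡ j - c - b
    minus-comm = solve-∀

  box-comm : ∀ a b f j → box a (box b f) j ≡ box b (box a f) j
  box-comm zero b f j = refl
  box-comm (suc a) b f j = begin
    box a (box b f) j + box b f (j - + suc a)           ≡⟨ cong₂ _+_ (box-comm a b f j) (sym (box-shift b f (+ suc a) j)) ⟩
    box b (box a f) j + box b (λ i → f (i - + suc a)) j ≡⟨ box-distrib-+ b (box a f) _ j ⟨
    box b (box (suc a) f) j                             ∎
    where open ≡-Reasoning

  boxes-↭ : ∀ {α α′} → α ↭ α′ → ∀ j → boxes α j ≡ boxes α′ j
  boxes-↭ ↭.refl j = refl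
  boxes-↭ (↭.prep a α↭α′) j = box-cong a (boxes-↭ α↭α′) j
  boxes-↭ (↭.swap {xs = α} a b α↭α′) j =
    trans (box-comm a b (boxes α) j) (box-cong b (box-cong a (boxes-↭ α↭α′)) j)
  boxes-↭ (↭.trans α↭α′ α′↭α″) j = trans (boxes-↭ α↭α′ j) (boxes-↭ α′↭α″ j)

  -- The two-row Jacobi–Trudi identity K_{(N-k,k),α} = [q^k] − [q^{k-1}] of ∏ᵢ (1 + ⋯ + q^{αᵢ}),
  -- generalised to an overhang h.
  mutual
    K₂≡boxes-difference : ∀ α h k → k ℕ.+ k ℕ.≤ h ℕ.+ sum α →
      + K₂ h k α ≡ boxes α (+ k) - boxes α (+ k - + suc h)
    K₂≡boxes-difference [] h zero _ = refl
    K₂≡boxes-difference [] h (suc k) 2k+2≤h+0 = cong (λ z → + 0 - z) (sym δ-negative)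
      where
      k<h : k ℕ.< h
      k<h = ℕ.≤-trans (ℕ.m≤m+n (suc k) (suc k)) (ℕ.≤-trans 2k+2≤h+0 (ℕ.≤-reflexive (ℕ.+-identityʳ h)))
      δ-minus : ∀ h k → k ℕ.< h → δℤ (- (+ (h ℕ.∸ k))) ≡ + 0
      δ-minus (suc h) zero _ = refl
      δ-minus (suc h) (suc k) (ℕ.s≤s k<h) = δ-minus h k k<h
      δ-negative : δℤ (+ suc k - + suc h) ≡ + 0
      δ-negative rewrite [1+m]-[1+n] k h | m-n≡m⊖n k h | ⊖-< k<h = δ-minus h k k<h
    K₂≡boxes-difference (a ∷ α) h k bound = K₂-place≡box-difference a α h k bound

    K₂-place≡box-difference : ∀ a α h k → k ℕ.+ k ℕ.≤ h ℕ.+ (a ℕ.+ sum α) →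
      + K₂-place h k a α ≡ box a (boxes α) (+ k) - box a (boxes α) (+ k - + suc h)
    K₂-place≡box-difference zero α h k bound = K₂≡boxes-difference α h k bound
    K₂-place≡box-difference (suc a) α (suc h) (suc k) bound = begin
      + K₂ (suc h ℕ.+ suc a) (suc k) α + + K₂-place h k a α
        ≡⟨ cong₂ _+_ (K₂≡boxes-difference α (suc h ℕ.+ suc a) (suc k) bound₁) (K₂-place≡box-difference a α h k bound₂) ⟩
      (Mα (+ suc k) - Mα (+ suc k - + suc (suc h ℕ.+ suc a))) + (box a Mα (+ k) - box a Mα (+ k - + suc h))
        ≡⟨ cong (λ z → (Mα (+ suc k) - Mα z) + (box a Mα (+ k) - box a Mα (+ k - + suc h))) (minus-+ (+ suc k) (+ suc (suc h)) (+ suc a)) ⟩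
      (Mα (+ suc k) - Mα (X - + suc a)) + (box a Mα (+ k) - box a Mα (+ k - + suc h))
        ≡⟨ cong (λ z → (Mα (+ suc k) - Mα (X - + suc a)) + (box a Mα (+ k) - box a Mα z)) (sym ([1+m]-[1+n] k (suc h))) ⟩
      (Mα (+ suc k) - Mα (X - + suc a)) + (box a Mα (+ k) - box a Mα X)
        ≡⟨ regroup (Mα (+ suc k)) (Mα (X - + suc a)) (box a Mα (+ k)) (box a Mα X) ⟩
      (Mα (+ suc k) + box a Mα (+ k)) - (box a Mα X + Mα (X - + suc a))
        ≡⟨ cong (_- (box a Mα X + Mα (X - + suc a))) (sym (box-unfoldˡ a Mα (+ suc k))) ⟩
      box (suc a) Mα (+ suc k) - box (suc a) Mα X ∎
      where
      open ≡-Reasoning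
      Mα = boxes α
      X = + suc k - + suc (suc h)
      regroup : ∀ A D B C → (A - D) + (B - C) ≡ (A + B) - (C + D)
      regroup = solve-∀
      bound₁ : suc k ℕ.+ suc k ℕ.≤ (suc h ℕ.+ suc a) ℕ.+ sum α
      bound₁ = ℕ.≤-trans bound (ℕ.≤-reflexive (sym (ℕ.+-assoc (suc h) (suc a) (sum α))))
      bound₂ : k ℕ.+ k ℕ.≤ h ℕ.+ (a ℕ.+ sum α)
      bound₂ = ℕ.≤-pred (ℕ.≤-pred (ℕ.≤-trans (ℕ.≤-reflexive (cong suc (sym (ℕ.+-suc k k))))
                 (ℕ.≤-trans bound (ℕ.≤-reflexive (cong suc (ℕ.+-suc h (a ℕ.+ sum α)))))))
    K₂-place≡box-difference (suc a) α zero k bound = begin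
      + (K₂ (suc a) k α ℕ.+ 0)            ≡⟨ cong +_ (ℕ.+-identityʳ _) ⟩
      + K₂ (suc a) k α                    ≡⟨ K₂≡boxes-difference α (suc a) k bound ⟩
      Mα (+ k) - Mα (+ k - + suc (suc a)) ≡⟨ cong (λ z → Mα (+ k) - Mα z) (minus-+ (+ k) (+ 1) (+ suc a)) ⟩
      Mα (+ k) - Mα (+ k - + 1 - + suc a) ≡⟨ add-both (Mα (+ k)) (box a Mα (+ k - + 1)) (Mα (+ k - + 1 - + suc a)) ⟩
      (Mα (+ k) + box a Mα (+ k - + 1)) - (box a Mα (+ k - + 1) + Mα (+ k - + 1 - + suc a))
        ≡⟨ cong (_- (box a Mα (+ k - + 1) + Mα (+ k - + 1 - + suc a))) (sym (box-unfoldˡ a Mα (+ k))) ⟩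
      box (suc a) Mα (+ k) - box (suc a) Mα (+ k - + 1) ∎
      where
      open ≡-Reasoning
      Mα = boxes α
      add-both : ∀ A E D → A - D ≡ (A + E) - (E + D)
      add-both = solve-∀
    K₂-place≡box-difference (suc a) α (suc h) zero _ = begin
      + (K₂ (suc h ℕ.+ suc a) 0 α ℕ.+ 0)            ≡⟨ cong +_ (ℕ.+-identityʳ _) ⟩
      + K₂ (suc h ℕ.+ suc a) 0 α                    ≡⟨ K₂≡boxes-difference α (suc h ℕ.+ suc a) 0 ℕ.z≤n ⟩
      Mα (+ 0) - Mα -[1+ (suc h ℕ.+ suc a) ]        ≡⟨ cong (λ z → Mα (+ 0) - z) (boxes-vanishes α _) ⟩
      Mα (+ 0) - + 0                                ≡⟨ pad (Mα (+ 0)) ⟩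
      (Mα (+ 0) + + 0) - + 0
        ≡⟨ cong₂ (λ u v → (Mα (+ 0) + u) - v) (sym (box-vanishes a Mα (boxes-vanishes α) 0))
                                              (sym (box-vanishes (suc a) Mα (boxes-vanishes α) (suc h))) ⟩
      (Mα (+ 0) + box a Mα -[1+ 0 ]) - box (suc a) Mα -[1+ suc h ]
        ≡⟨ cong (_- box (suc a) Mα -[1+ suc h ]) (sym (box-unfoldˡ a Mα (+ 0))) ⟩
      box (suc a) Mα (+ 0) - box (suc a) Mα -[1+ suc h ] ∎
      where
      open ≡-Reasoning
      Mα = boxes α
      pad : ∀ A → A - + 0 ≡ (A + + 0) - + 0
      pad = solve-∀

  K₂-↭ : ∀ {α α′} k → α ↭ α′ → k ℕ.+ k ℕ.≤ sum α → K₂ 0 k α ≡ K₂ 0 k α′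
  K₂-↭ {α} {α′} k α↭α′ 2k≤∑α = +-injective (begin
    + K₂ 0 k α                          ≡⟨ K₂≡boxes-difference α 0 k 2k≤∑α ⟩
    boxes α (+ k) - boxes α (+ k - + 1)   ≡⟨ cong₂ _-_ (boxes-↭ α↭α′ (+ k)) (boxes-↭ α↭α′ (+ k - + 1)) ⟩
    boxes α′ (+ k) - boxes α′ (+ k - + 1) ≡⟨ K₂≡boxes-difference α′ 0 k (ℕ.≤-trans 2k≤∑α (ℕ.≤-reflexive (sum-↭ α↭α′))) ⟨
    + K₂ 0 k α′                         ∎)
    where open ≡-Reasoning


module TableauRows where

  open BooleanComparisons
  open Sums
  open import Data.Nat using (ℕ; zero; suc; _+_; _*_; _≤_; _<_; s≤s; _≤ᵇ_; _≡ᵇ_)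
  open import Data.Nat.Properties
  open import Data.Bool using (Bool; true; false; _∧_)
  open import Data.Bool.Properties using (∧-zeroʳ; ∧-conicalˡ; ∧-conicalʳ)
  open import Data.List using (List; []; _∷_; map; upTo; length; drop; filterᵇ)
  open import Data.List.Properties using (drop-drop)
  open import Relation.Binary.PropositionalEquality
  open import Relation.Binary.Definitions using (tri<; tri≈; tri>)
  open import Function using (_∘_)
  open import Defs using (words; weakInc; strictCols; contentOK; occurrences)

  all≥ : ℕ → List ℕ → Bool
  all≥ s [] = true
  all≥ s (x ∷ w) = (s ≤ᵇ x) ∧ all≥ s w

  row≥ : ℕ → List ℕ → Bool
  row≥ s w = weakInc w ∧ all≥ s w

  all≥-mono : ∀ {s t} w → s ≤ t → all≥ t w ≡ true → all≥ s w ≡ true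
  all≥-mono [] _ _ = refl
  all≥-mono {s} {t} (x ∷ w) s≤t t≤w
    rewrite ≤ᵇ-true (≤-trans s≤t (≤ᵇ-sound t x (∧-conicalˡ _ _ t≤w))) = all≥-mono w s≤t (∧-conicalʳ _ _ t≤w)

  weakInc-∷ : ∀ x w → weakInc (x ∷ w) ≡ all≥ x w ∧ weakInc w
  weakInc-∷ x [] = refl
  weakInc-∷ x (y ∷ w) with x ≤ᵇ y in x≤y
  ... | false = refl
  ... | true rewrite weakInc-∷ y w with all≥ y w in y≤w | weakInc w
  ...   | true | true rewrite all≥-mono w (≤ᵇ-sound x y x≤y) y≤w = refl
  ...   | true | false = sym (∧-zeroʳ _)
  ...   | false | _ = sym (∧-zeroʳ _)

  ∑-words-suc : ∀ ℓ r (f : List ℕ → ℕ) → ∑ (words ℓ (suc r)) f ≡ ∑ (upTo ℓ) (λ y → ∑ (words ℓ r) (λ w → f (suc y ∷ w)))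
  ∑-words-suc ℓ r f = trans (∑-concatMap (λ x → map (x ∷_) (words ℓ r)) (map suc (upTo ℓ)) f)
    (trans (∑-map suc (upTo ℓ) _) (∑-upTo-cong ℓ (λ y _ → ∑-map (suc y ∷_) (words ℓ r) f)))

  ∑-words-cong : ∀ ℓ p (f g : List ℕ → ℕ) → (∀ w → all≥ 1 w ≡ true → f w ≡ g w) → ∑ (words ℓ p) f ≡ ∑ (words ℓ p) g
  ∑-words-cong ℓ zero f g f≗g = cong (_+ 0) (f≗g [] refl)
  ∑-words-cong ℓ (suc p) f g f≗g = trans (∑-words-suc ℓ p f)
    (trans (∑-upTo-cong ℓ (λ y _ → ∑-words-cong ℓ p _ _ (λ w 1≤w → f≗g (suc y ∷ w) 1≤w))) (sym (∑-words-suc ℓ p g)))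

  row≥-split : ∀ s x w (F : List ℕ → ℕ) →
    ⟦ row≥ s (x ∷ w) ⟧ * F (x ∷ w) ≡ ⟦ x ≡ᵇ s ⟧ * (⟦ row≥ s w ⟧ * F (s ∷ w)) + ⟦ row≥ (suc s) (x ∷ w) ⟧ * F (x ∷ w)
  row≥-split s x w F with <-cmp x s
  ... | tri< x<s _ _ = begin
    ⟦ row≥ s (x ∷ w) ⟧ * F (x ∷ w)          ≡⟨ cong (λ b → ⟦ weakInc (x ∷ w) ∧ (b ∧ all≥ s w) ⟧ * F (x ∷ w)) (≤ᵇ-false x<s) ⟩
    ⟦ weakInc (x ∷ w) ∧ false ⟧ * F (x ∷ w) ≡⟨ cong (λ b → ⟦ b ⟧ * F (x ∷ w)) (∧-zeroʳ (weakInc (x ∷ w))) ⟩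
    0                                       ≡⟨ cong₂ _+_ (cong (λ b → ⟦ b ⟧ * (⟦ row≥ s w ⟧ * F (s ∷ w))) (≢⇒≡ᵇ-false (<⇒≢ x<s)))
                                                         (cong (λ b → ⟦ b ⟧ * F (x ∷ w)) x∷w-not-row≥1+s) ⟨
    ⟦ x ≡ᵇ s ⟧ * (⟦ row≥ s w ⟧ * F (s ∷ w)) + ⟦ row≥ (suc s) (x ∷ w) ⟧ * F (x ∷ w) ∎
    where
    open ≡-Reasoning
    x∷w-not-row≥1+s : row≥ (suc s) (x ∷ w) ≡ false
    x∷w-not-row≥1+s rewrite ≤ᵇ-false {suc s} {x} (≤-trans x<s (n≤1+n s)) = ∧-zeroʳ _
  ... | tri≈ _ refl _
    rewrite ≡ᵇ-refl x | ≤ᵇ-false {suc x} {x} ≤-refl | ∧-zeroʳ (weakInc (x ∷ w)) | ≤ᵇ-true (≤-refl {x}) | weakInc-∷ x w =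
    sym (trans (+-identityʳ _) (trans (+-identityʳ _) (cong (λ b → ⟦ b ⟧ * F (x ∷ w)) (absorb (all≥ x w) (weakInc w)))))
    where
    absorb : ∀ a b → b ∧ a ≡ (a ∧ b) ∧ a
    absorb true true = refl
    absorb true false = refl
    absorb false b = ∧-zeroʳ b
  ... | tri> _ _ s<x
    rewrite ≢⇒≡ᵇ-false (<⇒≢ s<x ∘ sym) | ≤ᵇ-true (<⇒≤ s<x) | ≤ᵇ-true {suc s} {x} s<x | weakInc-∷ x w =
    cong (λ b → ⟦ b ⟧ * F (x ∷ w)) (bounds (all≥ x w) (weakInc w) refl)
    where
    bounds : ∀ a b → all≥ x w ≡ a → (a ∧ b) ∧ all≥ s w ≡ (a ∧ b) ∧ all≥ (suc s) w
    bounds true b x≤w rewrite all≥-mono {s} {x} w (<⇒≤ s<x) x≤w | all≥-mono {suc s} {x} w s<x x≤w = refl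
    bounds false b _ = refl

  ∑-row≥-split : ∀ ℓ s n (f : List ℕ → ℕ) → 1 ≤ s → s ≤ ℓ →
    ∑ (words ℓ (suc n)) (λ w → ⟦ row≥ s w ⟧ * f w) ≡
    ∑ (words ℓ n) (λ w → ⟦ row≥ s w ⟧ * f (s ∷ w)) + ∑ (words ℓ (suc n)) (λ w → ⟦ row≥ (suc s) w ⟧ * f w)
  ∑-row≥-split ℓ (suc s′) n f _ s≤ℓ = begin
    ∑ (words ℓ (suc n)) (λ w → ⟦ row≥ s w ⟧ * f w)
      ≡⟨ ∑-words-suc ℓ n _ ⟩
    ∑ (upTo ℓ) (λ y → ∑ (words ℓ n) (λ w → ⟦ row≥ s (suc y ∷ w) ⟧ * f (suc y ∷ w)))
      ≡⟨ ∑-cong (upTo ℓ) (λ y → ∑-cong (words ℓ n) (λ w → row≥-split s (suc y) w f)) ⟩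
    ∑ (upTo ℓ) (λ y → ∑ (words ℓ n) (λ w → ⟦ suc y ≡ᵇ s ⟧ * starting w + rest (suc y ∷ w)))
      ≡⟨ ∑-cong (upTo ℓ) (λ y → trans (∑-+ (words ℓ n) _ _)
           (cong (_+ ∑ (words ℓ n) (λ w → rest (suc y ∷ w))) (∑-*ˡ (words ℓ n) ⟦ suc y ≡ᵇ s ⟧ starting))) ⟩
    ∑ (upTo ℓ) (λ y → ⟦ y ≡ᵇ s′ ⟧ * #starting + ∑ (words ℓ n) (λ w → rest (suc y ∷ w)))
      ≡⟨ ∑-+ (upTo ℓ) _ _ ⟩
    ∑ (upTo ℓ) (λ y → ⟦ y ≡ᵇ s′ ⟧ * #starting) + ∑ (upTo ℓ) (λ y → ∑ (words ℓ n) (λ w → rest (suc y ∷ w)))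
      ≡⟨ cong₂ _+_ (∑-upTo-pick ℓ s′ (λ _ → #starting) s≤ℓ) (sym (∑-words-suc ℓ n rest)) ⟩
    #starting + ∑ (words ℓ (suc n)) rest ∎
    where
    open ≡-Reasoning
    s = suc s′
    starting rest : List ℕ → ℕ
    starting w = ⟦ row≥ s w ⟧ * f (s ∷ w)
    rest w = ⟦ row≥ (suc s) w ⟧ * f w
    #starting = ∑ (words ℓ n) starting

  ∑-row≥-beyond : ∀ ℓ n (f : List ℕ → ℕ) → ∑ (words ℓ (suc n)) (λ w → ⟦ row≥ (suc ℓ) w ⟧ * f w) ≡ 0
  ∑-row≥-beyond ℓ n f = trans (∑-words-suc ℓ n _)
    (trans (∑-upTo-cong ℓ (λ y y<ℓ → ∑-zero (words ℓ n) (λ w → too-large y w y<ℓ))) (∑-zero (upTo ℓ) (λ _ → refl)))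
    where
    too-large : ∀ y w → y < ℓ → ⟦ row≥ (suc ℓ) (suc y ∷ w) ⟧ * f (suc y ∷ w) ≡ 0
    too-large y w y<ℓ rewrite ≤ᵇ-false {suc ℓ} {suc y} (s≤s y<ℓ) | ∧-zeroʳ (weakInc (suc y ∷ w)) = refl

  occ : ℕ → List ℕ → ℕ
  occ j r = length (filterᵇ (_≡ᵇ j) r)

  occ-∷-same : ∀ s r → occ s (s ∷ r) ≡ suc (occ s r)
  occ-∷-same s r rewrite ≡ᵇ-refl s = refl

  occ-∷-other : ∀ j x r → (x ≡ᵇ j) ≡ false → occ j (x ∷ r) ≡ occ j r
  occ-∷-other j x r x≢j rewrite x≢j = refl

  occ-absent : ∀ s r → all≥ (suc s) r ≡ true → occ s r ≡ 0
  occ-absent s [] _ = refl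
  occ-absent s (x ∷ r) s<r = trans
    (occ-∷-other s x r (≢⇒≡ᵇ-false (λ x≡s → <⇒≢ (≤ᵇ-sound (suc s) x (∧-conicalˡ _ _ s<r)) (sym x≡s))))
    (occ-absent s r (∧-conicalʳ _ _ s<r))

  contentOK-cong : ∀ α j T T′ → (∀ i → j ≤ i → occurrences i T ≡ occurrences i T′) → contentOK j α T ≡ contentOK j α T′
  contentOK-cong [] j T T′ _ = refl
  contentOK-cong (a ∷ α) j T T′ same = cong₂ _∧_ (cong (_≡ᵇ a) (same j ≤-refl))
    (contentOK-cong α (suc j) T T′ (λ i j<i → same i (≤-trans (n≤1+n j) j<i)))

  content₂ : ℕ → List ℕ → List ℕ → List ℕ → Bool
  content₂ s α u l = contentOK s α (u ∷ l ∷ [])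

  content₂-lower∷ : ∀ s a α u l → content₂ s (a ∷ α) u (s ∷ l) ≡ (occ s u + suc (occ s l + 0) ≡ᵇ a) ∧ content₂ (suc s) α u l
  content₂-lower∷ s a α u l = cong₂ _∧_ (cong (λ z → (occ s u + (z + 0)) ≡ᵇ a) (occ-∷-same s l))
    (contentOK-cong α (suc s) _ _ (λ i s<i → cong (λ z → occ i u + (z + 0)) (occ-∷-other i s l (≢⇒≡ᵇ-false (<⇒≢ s<i)))))

  content₂-lower∷-zero : ∀ s α u l → content₂ s (0 ∷ α) u (s ∷ l) ≡ false
  content₂-lower∷-zero s α u l rewrite content₂-lower∷ s 0 α u l | +-suc (occ s u) (occ s l + 0) = refl

  content₂-lower∷-suc : ∀ s a α u l → content₂ s (suc a ∷ α) u (s ∷ l) ≡ content₂ s (a ∷ α) u l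
  content₂-lower∷-suc s a α u l rewrite content₂-lower∷ s (suc a) α u l | +-suc (occ s u) (occ s l + 0) = refl

  content₂-upper∷ : ∀ s a α u l → content₂ s (a ∷ α) (s ∷ u) l ≡ (suc (occ s u) + (occ s l + 0) ≡ᵇ a) ∧ content₂ (suc s) α u l
  content₂-upper∷ s a α u l = cong₂ _∧_ (cong (λ z → (z + (occ s l + 0)) ≡ᵇ a) (occ-∷-same s u))
    (contentOK-cong α (suc s) _ _ (λ i s<i → cong (λ z → z + (occ i l + 0)) (occ-∷-other i s u (≢⇒≡ᵇ-false (<⇒≢ s<i)))))

  content₂-upper∷-zero : ∀ s α u l → content₂ s (0 ∷ α) (s ∷ u) l ≡ false
  content₂-upper∷-zero s α u l rewrite content₂-upper∷ s 0 α u l = refl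

  content₂-upper∷-suc : ∀ s a α u l → content₂ s (suc a ∷ α) (s ∷ u) l ≡ content₂ s (a ∷ α) u l
  content₂-upper∷-suc s a α u l rewrite content₂-upper∷ s (suc a) α u l = refl

  content₂-absent : ∀ s a α u l → all≥ (suc s) u ≡ true → all≥ (suc s) l ≡ true →
    content₂ s (a ∷ α) u l ≡ (0 ≡ᵇ a) ∧ content₂ (suc s) α u l
  content₂-absent s a α u l s<u s<l rewrite occ-absent s u s<u | occ-absent s l s<l = refl

  strictCols-blocked : ∀ s u l → all≥ s u ≡ true → strictCols u (s ∷ l) ≡ false
  strictCols-blocked s [] l _ = refl
  strictCols-blocked s (x ∷ u) l s≤x∷u rewrite <ᵇ-false {x} {s} (≤ᵇ-sound s x (∧-conicalˡ _ _ s≤x∷u)) = refl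

  all≥-drop : ∀ s h l → all≥ s l ≡ true → all≥ s (drop h l) ≡ true
  all≥-drop s zero l s≤l = s≤l
  all≥-drop s (suc h) [] _ = refl
  all≥-drop s (suc h) (x ∷ l) s≤x∷l = all≥-drop s h l (∧-conicalʳ _ _ s≤x∷l)

  strictCols-upper∷ : ∀ s h u l → all≥ (suc s) l ≡ true → strictCols (s ∷ u) (drop h l) ≡ strictCols u (drop (suc h) l)
  strictCols-upper∷ s h u l s<l = trans (below-s (drop h l) (all≥-drop (suc s) h l s<l))
    (cong (strictCols u) (trans (drop-drop h 1 l) (cong (λ i → drop i l) (+-comm h 1))))
    where
    below-s : ∀ r → all≥ (suc s) r ≡ true → strictCols (s ∷ u) r ≡ strictCols u (drop 1 r)
    below-s [] _ = refl
    below-s (y ∷ r) s<y∷r rewrite <ᵇ-true {s} {y} (≤ᵇ-sound (suc s) y (∧-conicalˡ _ _ s<y∷r)) = refl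


module TwoRowKostka where

  open BooleanComparisons
  open Sums
  open TwoRowCount
  open TableauRows
  open import Data.Nat using (ℕ; zero; suc; _+_; _*_; _∸_; _≤_; _<_; z≤n; s≤s; _≡ᵇ_)
  open import Data.Nat.Properties
  open import Data.Bool using (Bool; true; false; _∧_)
  open import Data.Bool.Properties using (∧-zeroʳ; ∧-conicalʳ)
  open import Data.List using (List; []; _∷_; map; length; drop; filterᵇ)
  open import Data.List.Properties using (drop-[])
  open import Data.Nat.ListAction using (sum)
  open import Relation.Binary.PropositionalEquality
  open import Relation.Nullary.Decidable using (T?)
  open import Algebra.Properties.CommutativeSemigroup *-commutativeSemigroup using (x∙yz≈y∙xz)
  open import Defs using (words; weakInc; strictCols; contentOK; kostka; twoRow; fillings; isSSYT)

  ⟦∧∧⟧ : ∀ x c y → ⟦ x ∧ (c ∧ y) ⟧ ≡ ⟦ c ⟧ * ⟦ x ∧ y ⟧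
  ⟦∧∧⟧ x true y = sym (+-identityʳ _)
  ⟦∧∧⟧ x false y = cong ⟦_⟧ (∧-zeroʳ x)

  -- Letters range over 1 … ℓ. #fill s h α p q counts the pairs of rows u (length p) and
  -- l (length q) with letters ≥ s and content α for the letters s, s+1, …, that can be
  -- completed to a tableau whose letters < s are already placed, the upper row
  -- overhanging the lower one by h cells: so l must be column-strict under u from
  -- its (h+1)-st cell on. #fill′ additionally forbids the letter s in l.
  module TwoRowFillings (ℓ : ℕ) where

    compatible : ℕ → ℕ → List ℕ → List ℕ → List ℕ → Bool
    compatible s h α u l = strictCols u (drop h l) ∧ content₂ s α u l

    #fill : ℕ → ℕ → List ℕ → ℕ → ℕ → ℕ
    #fill s h α p q = ∑ (words ℓ p) (λ u → ⟦ row≥ s u ⟧ * ∑ (words ℓ q) (λ l → ⟦ row≥ s l ⟧ * ⟦ compatible s h α u l ⟧))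

    #fill′ : ℕ → ℕ → List ℕ → ℕ → ℕ → ℕ
    #fill′ s h α p q = ∑ (words ℓ p) (λ u → ⟦ row≥ s u ⟧ * ∑ (words ℓ q) (λ l → ⟦ row≥ (suc s) l ⟧ * ⟦ compatible s h α u l ⟧))

    #fill-lower : ℕ → ℕ → ℕ → List ℕ → ℕ → ℕ → ℕ
    #fill-lower s (suc h) (suc a) α p q = #fill s h (a ∷ α) p q
    #fill-lower s zero a α p q = 0
    #fill-lower s (suc h) zero α p q = 0

    #fill-upper : ℕ → ℕ → ℕ → List ℕ → ℕ → ℕ → ℕ
    #fill-upper s h (suc a) α (suc p) q = #fill′ s (suc h) (a ∷ α) p q
    #fill-upper s h zero α p q = 0
    #fill-upper s h (suc a) α zero q = 0

    ∑-row≥-cong : ∀ s n (f g : List ℕ → ℕ) → (∀ u → row≥ s u ≡ true → f u ≡ g u) →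
      ∑ (words ℓ n) (λ u → ⟦ row≥ s u ⟧ * f u) ≡ ∑ (words ℓ n) (λ u → ⟦ row≥ s u ⟧ * g u)
    ∑-row≥-cong s n f g f≗g = ∑-cong (words ℓ n) (λ u → ⟦⟧*-cong (row≥ s u) (f≗g u))

    ∑-row≥-zero : ∀ s n (f : List ℕ → ℕ) → (∀ u → row≥ s u ≡ true → f u ≡ 0) → ∑ (words ℓ n) (λ u → ⟦ row≥ s u ⟧ * f u) ≡ 0
    ∑-row≥-zero s n f f≗0 = trans (∑-row≥-cong s n f (λ _ → 0) f≗0) (∑-zero (words ℓ n) (λ u → *-zeroʳ ⟦ row≥ s u ⟧))

    #fill-split : ∀ s h a α p q → 1 ≤ s → s ≤ ℓ →
      #fill s h (a ∷ α) p (suc q) ≡ #fill′ s h (a ∷ α) p (suc q) + #fill-lower s h a α p q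
    #fill-split s h a α p q 1≤s s≤ℓ = begin
      #fill s h (a ∷ α) p (suc q)
        ≡⟨ ∑-cong (words ℓ p) (λ u → cong (⟦ row≥ s u ⟧ *_) (∑-row≥-split ℓ s q (λ l → ⟦ compatible s h (a ∷ α) u l ⟧) 1≤s s≤ℓ)) ⟩
      ∑ (words ℓ p) (λ u → ⟦ row≥ s u ⟧ * (lower-starts-with-s u + lower-above-s u))
        ≡⟨ ∑-cong (words ℓ p) (λ u → trans (*-distribˡ-+ ⟦ row≥ s u ⟧ _ _) (+-comm (⟦ row≥ s u ⟧ * lower-starts-with-s u) _)) ⟩
      ∑ (words ℓ p) (λ u → ⟦ row≥ s u ⟧ * lower-above-s u + ⟦ row≥ s u ⟧ * lower-starts-with-s u)
        ≡⟨ ∑-+ (words ℓ p) _ _ ⟩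
      #fill′ s h (a ∷ α) p (suc q) + ∑ (words ℓ p) (λ u → ⟦ row≥ s u ⟧ * lower-starts-with-s u)
        ≡⟨ cong (#fill′ s h (a ∷ α) p (suc q) +_) (peel-lower h a) ⟩
      #fill′ s h (a ∷ α) p (suc q) + #fill-lower s h a α p q ∎
      where
      open ≡-Reasoning
      lower-starts-with-s lower-above-s : List ℕ → ℕ
      lower-starts-with-s u = ∑ (words ℓ q) (λ l → ⟦ row≥ s l ⟧ * ⟦ compatible s h (a ∷ α) u (s ∷ l) ⟧)
      lower-above-s u = ∑ (words ℓ (suc q)) (λ l → ⟦ row≥ (suc s) l ⟧ * ⟦ compatible s h (a ∷ α) u l ⟧)
      peel-lower : ∀ h a → ∑ (words ℓ p) (λ u → ⟦ row≥ s u ⟧ * ∑ (words ℓ q) (λ l → ⟦ row≥ s l ⟧ * ⟦ compatible s h (a ∷ α) u (s ∷ l) ⟧))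
                           ≡ #fill-lower s h a α p q
      peel-lower zero a = ∑-row≥-zero s p _ (λ u u-row → ∑-zero (words ℓ q) (λ l → trans
        (cong (λ b → ⟦ row≥ s l ⟧ * ⟦ b ∧ content₂ s (a ∷ α) u (s ∷ l) ⟧) (strictCols-blocked s u l (∧-conicalʳ (weakInc u) _ u-row)))
        (*-zeroʳ ⟦ row≥ s l ⟧)))
      peel-lower (suc h) zero = ∑-row≥-zero s p _ (λ u _ → ∑-zero (words ℓ q) (λ l → trans
        (cong (λ b → ⟦ row≥ s l ⟧ * ⟦ strictCols u (drop h l) ∧ b ⟧) (content₂-lower∷-zero s α u l))
        (trans (cong (λ b → ⟦ row≥ s l ⟧ * ⟦ b ⟧) (∧-zeroʳ _)) (*-zeroʳ ⟦ row≥ s l ⟧))))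
      peel-lower (suc h) (suc a) = ∑-cong (words ℓ p) (λ u → cong (⟦ row≥ s u ⟧ *_) (∑-cong (words ℓ q) (λ l →
        cong (λ b → ⟦ row≥ s l ⟧ * ⟦ strictCols u (drop h l) ∧ b ⟧) (content₂-lower∷-suc s a α u l))))

    letter-s-absent : ∀ s h a α q u → all≥ (suc s) u ≡ true →
      ∑ (words ℓ q) (λ l → ⟦ row≥ (suc s) l ⟧ * ⟦ compatible s h (a ∷ α) u l ⟧) ≡
      ⟦ 0 ≡ᵇ a ⟧ * ∑ (words ℓ q) (λ l → ⟦ row≥ (suc s) l ⟧ * ⟦ compatible (suc s) h α u l ⟧)
    letter-s-absent s h a α q u s<u = trans (∑-row≥-cong (suc s) q _ _ no-s)
      (trans (∑-cong (words ℓ q) (λ l → x∙yz≈y∙xz ⟦ row≥ (suc s) l ⟧ ⟦ 0 ≡ᵇ a ⟧ _)) (∑-*ˡ (words ℓ q) ⟦ 0 ≡ᵇ a ⟧ _))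
      where
      no-s : ∀ l → row≥ (suc s) l ≡ true → ⟦ compatible s h (a ∷ α) u l ⟧ ≡ ⟦ 0 ≡ᵇ a ⟧ * ⟦ compatible (suc s) h α u l ⟧
      no-s l l-row rewrite content₂-absent s a α u l s<u (∧-conicalʳ (weakInc l) _ l-row) =
        ⟦∧∧⟧ (strictCols u (drop h l)) (0 ≡ᵇ a) (content₂ (suc s) α u l)

    #fill′-split : ∀ s h a α p q → 1 ≤ s → s ≤ ℓ →
      #fill′ s h (a ∷ α) p q ≡ #fill-upper s h a α p q + ⟦ 0 ≡ᵇ a ⟧ * #fill (suc s) h α p q
    #fill′-split s h a α zero q _ _ = begin
      (∑ (words ℓ q) (λ l → ⟦ row≥ (suc s) l ⟧ * ⟦ compatible s h (a ∷ α) [] l ⟧) + 0) + 0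
        ≡⟨ cong (λ z → (z + 0) + 0) (letter-s-absent s h a α q [] refl) ⟩
      (⟦ 0 ≡ᵇ a ⟧ * rest + 0) + 0  ≡⟨ trans (+-identityʳ _) (+-identityʳ _) ⟩
      ⟦ 0 ≡ᵇ a ⟧ * rest            ≡⟨ cong (⟦ 0 ≡ᵇ a ⟧ *_) (sym (trans (+-identityʳ _) (+-identityʳ _))) ⟩
      ⟦ 0 ≡ᵇ a ⟧ * ((rest + 0) + 0) ≡⟨ cong (_+ ⟦ 0 ≡ᵇ a ⟧ * ((rest + 0) + 0)) (no-upper a) ⟨
      #fill-upper s h a α zero q + ⟦ 0 ≡ᵇ a ⟧ * ((rest + 0) + 0) ∎
      where
      open ≡-Reasoning
      rest = ∑ (words ℓ q) (λ l → ⟦ row≥ (suc s) l ⟧ * ⟦ compatible (suc s) h α [] l ⟧)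
      no-upper : ∀ a → #fill-upper s h a α zero q ≡ 0
      no-upper zero = refl
      no-upper (suc a) = refl
    #fill′-split s h a α (suc p) q 1≤s s≤ℓ = begin
      #fill′ s h (a ∷ α) (suc p) q
        ≡⟨ ∑-row≥-split ℓ s p lower 1≤s s≤ℓ ⟩
      ∑ (words ℓ p) (λ u → ⟦ row≥ s u ⟧ * lower (s ∷ u)) + ∑ (words ℓ (suc p)) (λ u → ⟦ row≥ (suc s) u ⟧ * lower u)
        ≡⟨ cong₂ _+_ (peel-upper a) letter-s-nowhere ⟩
      #fill-upper s h a α (suc p) q + ⟦ 0 ≡ᵇ a ⟧ * #fill (suc s) h α (suc p) q ∎
      where
      open ≡-Reasoning
      lower : List ℕ → ℕ
      lower u = ∑ (words ℓ q) (λ l → ⟦ row≥ (suc s) l ⟧ * ⟦ compatible s h (a ∷ α) u l ⟧)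
      peel-upper : ∀ a → ∑ (words ℓ p) (λ u → ⟦ row≥ s u ⟧ * ∑ (words ℓ q) (λ l → ⟦ row≥ (suc s) l ⟧ * ⟦ compatible s h (a ∷ α) (s ∷ u) l ⟧))
                         ≡ #fill-upper s h a α (suc p) q
      peel-upper zero = ∑-zero (words ℓ p) (λ u → trans (cong (⟦ row≥ s u ⟧ *_) (∑-zero (words ℓ q) (λ l → trans
        (cong (λ b → ⟦ row≥ (suc s) l ⟧ * ⟦ strictCols (s ∷ u) (drop h l) ∧ b ⟧) (content₂-upper∷-zero s α u l))
        (trans (cong (λ b → ⟦ row≥ (suc s) l ⟧ * ⟦ b ⟧) (∧-zeroʳ _)) (*-zeroʳ ⟦ row≥ (suc s) l ⟧))))) (*-zeroʳ ⟦ row≥ s u ⟧))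
      peel-upper (suc a) = ∑-cong (words ℓ p) (λ u → cong (⟦ row≥ s u ⟧ *_) (∑-row≥-cong (suc s) q _ _ (λ l l-row →
        cong ⟦_⟧ (cong₂ _∧_ (strictCols-upper∷ s h u l (∧-conicalʳ (weakInc l) _ l-row)) (content₂-upper∷-suc s a α u l)))))
      letter-s-nowhere : ∑ (words ℓ (suc p)) (λ u → ⟦ row≥ (suc s) u ⟧ * lower u) ≡ ⟦ 0 ≡ᵇ a ⟧ * #fill (suc s) h α (suc p) q
      letter-s-nowhere = trans (∑-row≥-cong (suc s) (suc p) _ _ (λ u u-row → letter-s-absent s h a α q u (∧-conicalʳ (weakInc u) _ u-row)))
        (trans (∑-cong (words ℓ (suc p)) (λ u → x∙yz≈y∙xz ⟦ row≥ (suc s) u ⟧ ⟦ 0 ≡ᵇ a ⟧ _)) (∑-*ˡ (words ℓ (suc p)) ⟦ 0 ≡ᵇ a ⟧ _))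

    #fill-exhausted : ∀ h p q → #fill (suc ℓ) h [] p q ≡ ⟦ p ≡ᵇ 0 ⟧ * ⟦ q ≡ᵇ 0 ⟧
    #fill-exhausted h zero zero rewrite drop-[] {A = ℕ} h = refl
    #fill-exhausted h zero (suc q) = cong (λ z → z + 0 + 0) (∑-row≥-beyond ℓ q _)
    #fill-exhausted h (suc p) q = ∑-row≥-beyond ℓ p _

    private
      s≤ℓ : ∀ s a (α : List ℕ) → s + length (a ∷ α) ≡ suc ℓ → s ≤ ℓ
      s≤ℓ s a α s+∣α∣≡1+ℓ = subst (s ≤_) (suc-injective (trans (sym (+-suc s (length α))) s+∣α∣≡1+ℓ)) (m≤m+n s (length α))

      ifBothPositive : ℕ → ℕ → ℕ → ℕ
      ifBothPositive (suc h) (suc a) x = x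
      ifBothPositive zero a x = 0
      ifBothPositive (suc h) zero x = 0

    mutual
      #fill≡K₂ : ∀ α s h p q → s + length α ≡ suc ℓ → 1 ≤ s → #fill s h α p q ≡ ⟦ p + q ≡ᵇ sum α ⟧ * K₂ h q α
      #fill≡K₂ [] s h p q s≡1+ℓ _ rewrite +-identityʳ s | s≡1+ℓ = trans (#fill-exhausted h p q) (empty p q)
        where
        empty : ∀ p q → ⟦ p ≡ᵇ 0 ⟧ * ⟦ q ≡ᵇ 0 ⟧ ≡ ⟦ p + q ≡ᵇ 0 ⟧ * δ₀ q
        empty zero zero = refl
        empty zero (suc q) = refl
        empty (suc p) q = refl
      #fill≡K₂ (a ∷ α) s h p q s+∣α∣≡1+ℓ 1≤s = #fill≡K₂-place a α s h p q s+∣α∣≡1+ℓ 1≤s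

      #fill≡K₂-place : ∀ a α s h p q → s + length (a ∷ α) ≡ suc ℓ → 1 ≤ s →
        #fill s h (a ∷ α) p q ≡ ⟦ p + q ≡ᵇ a + sum α ⟧ * K₂-place h q a α
      #fill≡K₂-place a α s h p zero s+∣α∣≡1+ℓ 1≤s =
        trans (#fill′≡K₂ a α s h p zero s+∣α∣≡1+ℓ 1≤s) (cong (⟦ p + zero ≡ᵇ a + sum α ⟧ *_) (all-upper h a))
        where
        all-upper : ∀ h a → K₂ (h + a) zero α ≡ K₂-place h zero a α
        all-upper h zero = cong (λ z → K₂ z zero α) (+-identityʳ h)
        all-upper zero (suc a) = sym (+-identityʳ _)
        all-upper (suc h) (suc a) = sym (+-identityʳ _)
      #fill≡K₂-place a α s h p (suc q) s+∣α∣≡1+ℓ 1≤s = begin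
        #fill s h (a ∷ α) p (suc q)
          ≡⟨ #fill-split s h a α p q 1≤s (s≤ℓ s a α s+∣α∣≡1+ℓ) ⟩
        #fill′ s h (a ∷ α) p (suc q) + #fill-lower s h a α p q
          ≡⟨ cong₂ _+_ (#fill′≡K₂ a α s h p (suc q) s+∣α∣≡1+ℓ 1≤s) (lower h a) ⟩
        sums-to a * K₂ (h + a) (suc q) α + ifBothPositive h a (sums-to a * K₂-place↓ h (suc q) (a ∸ 1) α)
          ≡⟨ recombine h a ⟩
        sums-to a * K₂-place h (suc q) a α ∎
        where
        open ≡-Reasoning
        sums-to : ℕ → ℕ
        sums-to a = ⟦ p + suc q ≡ᵇ a + sum α ⟧
        lower : ∀ h a → #fill-lower s h a α p q ≡ ifBothPositive h a (sums-to a * K₂-place↓ h (suc q) (a ∸ 1) α)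
        lower zero a = refl
        lower (suc h) zero = refl
        lower (suc h) (suc a) rewrite +-suc p q = #fill≡K₂-place a α s h p q s+∣α∣≡1+ℓ 1≤s
        recombine : ∀ h a → sums-to a * K₂ (h + a) (suc q) α + ifBothPositive h a (sums-to a * K₂-place↓ h (suc q) (a ∸ 1) α)
                            ≡ sums-to a * K₂-place h (suc q) a α
        recombine zero zero = +-identityʳ _
        recombine (suc h) zero = trans (+-identityʳ _) (cong (λ z → sums-to zero * K₂ z (suc q) α) (+-identityʳ (suc h)))
        recombine zero (suc a) = trans (+-identityʳ _) (cong (sums-to (suc a) *_) (sym (+-identityʳ _)))
        recombine (suc h) (suc a) = sym (*-distribˡ-+ (sums-to (suc a)) _ _)

      #fill′≡K₂ : ∀ a α s h p q → s + length (a ∷ α) ≡ suc ℓ → 1 ≤ s →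
        #fill′ s h (a ∷ α) p q ≡ ⟦ p + q ≡ᵇ a + sum α ⟧ * K₂ (h + a) q α
      #fill′≡K₂ a α s h p q s+∣α∣≡1+ℓ 1≤s = begin
        #fill′ s h (a ∷ α) p q
          ≡⟨ #fill′-split s h a α p q 1≤s (s≤ℓ s a α s+∣α∣≡1+ℓ) ⟩
        #fill-upper s h a α p q + ⟦ 0 ≡ᵇ a ⟧ * #fill (suc s) h α p q
          ≡⟨ cong (λ z → #fill-upper s h a α p q + ⟦ 0 ≡ᵇ a ⟧ * z)
               (#fill≡K₂ α (suc s) h p q (trans (sym (+-suc s (length α))) s+∣α∣≡1+ℓ) (≤-trans 1≤s (n≤1+n s))) ⟩
        #fill-upper s h a α p q + ⟦ 0 ≡ᵇ a ⟧ * (⟦ p + q ≡ᵇ sum α ⟧ * K₂ h q α)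
          ≡⟨ upper a p ⟩
        ⟦ p + q ≡ᵇ a + sum α ⟧ * K₂ (h + a) q α ∎
        where
        open ≡-Reasoning
        upper : ∀ a p → #fill-upper s h a α p q + ⟦ 0 ≡ᵇ a ⟧ * (⟦ p + q ≡ᵇ sum α ⟧ * K₂ h q α) ≡ ⟦ p + q ≡ᵇ a + sum α ⟧ * K₂ (h + a) q α
        upper zero p = trans (+-identityʳ _) (cong (λ z → ⟦ p + q ≡ᵇ sum α ⟧ * K₂ z q α) (sym (+-identityʳ h)))
        upper (suc a) (suc p) = trans (+-identityʳ _) (trans (#fill′≡K₂ a α s (suc h) p q s+∣α∣≡1+ℓ 1≤s)
          (cong (λ z → ⟦ p + q ≡ᵇ a + sum α ⟧ * K₂ z q α) (sym (+-suc h a))))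
        upper (suc a) zero with q ≡ᵇ suc (a + sum α) in q≡
        ... | true = trans (+-identityʳ _) (sym (trans (+-identityʳ _)
          (K₂-vanish (h + suc a) q α (subst (sum α <_) (sym (≡ᵇ-sound _ _ q≡)) (s≤s (m≤n+m (sum α) a))))))
        ... | false = refl

  private
    length-filterᵇ : ∀ {A : Set} (p : A → Bool) (xs : List A) → length (filterᵇ p xs) ≡ ∑ xs (λ x → ⟦ p x ⟧)
    length-filterᵇ p xs = length-filter (λ x → T? (p x)) xs

    one-row : ∀ a d → ⟦ ((a ∧ true) ∧ true) ∧ d ⟧ + 0 ≡ ⟦ a ∧ true ⟧ * (1 * ⟦ true ∧ d ⟧ + 0)
    one-row true true = refl
    one-row true false = refl
    one-row false d = refl

    two-rows : ∀ a b c d → ⟦ ((a ∧ (b ∧ true)) ∧ (c ∧ true)) ∧ d ⟧ + 0 ≡ ⟦ a ∧ true ⟧ * (⟦ b ∧ true ⟧ * ⟦ c ∧ d ⟧)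
    two-rows true true true true = refl
    two-rows true true true false = refl
    two-rows true true false d = refl
    two-rows true false c d = refl
    two-rows false b c d = refl

  kostka≡#fill : ∀ N k α → kostka (twoRow N k) α ≡ TwoRowFillings.#fill (length α) 1 0 α (N ∸ k) k
  kostka≡#fill N zero α = begin
    kostka (N ∷ []) α
      ≡⟨ length-filterᵇ (λ T → isSSYT T ∧ contentOK 1 α T) (fillings ℓ (N ∷ [])) ⟩
    ∑ (fillings ℓ (N ∷ [])) (λ T → ⟦ isSSYT T ∧ contentOK 1 α T ⟧)
      ≡⟨ ∑-concatMap _ (words ℓ N) _ ⟩
    ∑ (words ℓ N) (λ u → ⟦ isSSYT (u ∷ []) ∧ contentOK 1 α (u ∷ []) ⟧ + 0)
      ≡⟨ ∑-words-cong ℓ N _ _ as-#fill ⟩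
    TwoRowFillings.#fill ℓ 1 0 α N 0 ∎
    where
    open ≡-Reasoning
    ℓ = length α
    as-#fill : ∀ u → all≥ 1 u ≡ true →
      ⟦ isSSYT (u ∷ []) ∧ contentOK 1 α (u ∷ []) ⟧ + 0 ≡ ⟦ row≥ 1 u ⟧ * (⟦ row≥ 1 [] ⟧ * ⟦ strictCols u [] ∧ content₂ 1 α u [] ⟧ + 0)
    as-#fill u 1≤u rewrite 1≤u | contentOK-cong α 1 (u ∷ [] ∷ []) (u ∷ []) (λ i _ → refl) = one-row (weakInc u) (contentOK 1 α (u ∷ []))
  kostka≡#fill N (suc k) α = begin
    kostka (twoRow N (suc k)) α
      ≡⟨ length-filterᵇ (λ T → isSSYT T ∧ contentOK 1 α T) (fillings ℓ (p ∷ q ∷ [])) ⟩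
    ∑ (fillings ℓ (p ∷ q ∷ [])) (λ T → ⟦ isSSYT T ∧ contentOK 1 α T ⟧)
      ≡⟨ ∑-concatMap _ (words ℓ p) _ ⟩
    ∑ (words ℓ p) (λ u → ∑ (map (u ∷_) (fillings ℓ (q ∷ []))) (λ T → ⟦ isSSYT T ∧ contentOK 1 α T ⟧))
      ≡⟨ ∑-cong (words ℓ p) (λ u → trans (∑-map (u ∷_) (fillings ℓ (q ∷ [])) _) (∑-concatMap _ (words ℓ q) _)) ⟩
    ∑ (words ℓ p) (λ u → ∑ (words ℓ q) (λ l → ⟦ isSSYT (u ∷ l ∷ []) ∧ contentOK 1 α (u ∷ l ∷ []) ⟧ + 0))
      ≡⟨ ∑-words-cong ℓ p _ _ (λ u 1≤u → trans (∑-words-cong ℓ q _ _ (λ l 1≤l → as-#fill u l 1≤u 1≤l)) (∑-*ˡ (words ℓ q) ⟦ row≥ 1 u ⟧ _)) ⟩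
    TwoRowFillings.#fill ℓ 1 0 α p q ∎
    where
    open ≡-Reasoning
    ℓ = length α
    p = N ∸ suc k
    q = suc k
    as-#fill : ∀ u l → all≥ 1 u ≡ true → all≥ 1 l ≡ true →
      ⟦ isSSYT (u ∷ l ∷ []) ∧ contentOK 1 α (u ∷ l ∷ []) ⟧ + 0 ≡ ⟦ row≥ 1 u ⟧ * (⟦ row≥ 1 l ⟧ * ⟦ strictCols u l ∧ content₂ 1 α u l ⟧)
    as-#fill u l 1≤u 1≤l rewrite 1≤u | 1≤l = two-rows (weakInc u) (weakInc l) (strictCols u l) (contentOK 1 α (u ∷ l ∷ []))

  kostka≡K₂ : ∀ N k α → sum α ≡ N → k ≤ N → kostka (twoRow N k) α ≡ K₂ 0 k α
  kostka≡K₂ N k α ∑α≡N k≤N = begin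
    kostka (twoRow N k) α                           ≡⟨ kostka≡#fill N k α ⟩
    TwoRowFillings.#fill (length α) 1 0 α (N ∸ k) k ≡⟨ TwoRowFillings.#fill≡K₂ (length α) α 1 0 (N ∸ k) k refl (s≤s z≤n) ⟩
    ⟦ (N ∸ k) + k ≡ᵇ sum α ⟧ * K₂ 0 k α             ≡⟨ cong (λ z → ⟦ z ≡ᵇ sum α ⟧ * K₂ 0 k α) (trans (m∸n+n≡m k≤N) (sym ∑α≡N)) ⟩
    ⟦ sum α ≡ᵇ sum α ⟧ * K₂ 0 k α                   ≡⟨ cong (λ b → ⟦ b ⟧ * K₂ 0 k α) (≡ᵇ-refl (sum α)) ⟩
    K₂ 0 k α + 0                                    ≡⟨ +-identityʳ _ ⟩
    K₂ 0 k α                                        ∎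
    where open ≡-Reasoning


module TwoRowPartitions where

  open BooleanComparisons
  open Sums
  open import Data.Nat using (ℕ; zero; suc; _+_; _*_; _∸_; _≤_; z≤n; s≤s; _≡ᵇ_; _⊓_)
  open import Data.Nat.Properties
  open import Data.Bool using (Bool; true; false; _∧_)
  open import Data.List using (List; []; _∷_; map; upTo)
  open import Relation.Binary.PropositionalEquality
  open import Defs using (partsB; partitions; twoRow)

  _==ᴸ_ : List ℕ → List ℕ → Bool
  [] ==ᴸ [] = true
  (x ∷ xs) ==ᴸ (y ∷ ys) = (x ≡ᵇ y) ∧ (xs ==ᴸ ys)
  [] ==ᴸ (y ∷ ys) = false
  (x ∷ xs) ==ᴸ [] = false

  ==ᴸ⇒≡ : ∀ xs ys → (xs ==ᴸ ys) ≡ true → xs ≡ ys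
  ==ᴸ⇒≡ [] [] _ = refl
  ==ᴸ⇒≡ (x ∷ xs) (y ∷ ys) xs==ys with x ≡ᵇ y in x≡ᵇy
  ... | true = cong₂ _∷_ (≡ᵇ-sound x y x≡ᵇy) (==ᴸ⇒≡ xs ys xs==ys)

  private
    count-∷ : ∀ j t ν (Λ : List (List ℕ)) → ∑ (map (j ∷_) Λ) (λ λs → ⟦ λs ==ᴸ (t ∷ ν) ⟧) ≡ ⟦ j ≡ᵇ t ⟧ * ∑ Λ (λ μ → ⟦ μ ==ᴸ ν ⟧)
    count-∷ j t ν Λ = trans (∑-map (j ∷_) Λ _) (trans (∑-cong Λ (λ μ → ⟦∧⟧ (j ≡ᵇ t) (μ ==ᴸ ν))) (∑-*ˡ Λ ⟦ j ≡ᵇ t ⟧ _))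

    ∑-sucs-pick : ∀ n t (g : ℕ → ℕ) → 1 ≤ t → t ≤ n → ∑ (map suc (upTo n)) (λ j → ⟦ j ≡ᵇ t ⟧ * g j) ≡ g t
    ∑-sucs-pick n (suc t) g _ t<n = trans (∑-map suc (upTo n) _) (∑-upTo-pick n t (λ y → g (suc y)) t<n)

    count-first-part : ∀ f n b t ν → 1 ≤ t → t ≤ suc n ⊓ b →
      ∑ (partsB (suc f) (suc n) b) (λ λs → ⟦ λs ==ᴸ (t ∷ ν) ⟧) ≡ ∑ (partsB f (suc n ∸ t) t) (λ μ → ⟦ μ ==ᴸ ν ⟧)
    count-first-part f n b t ν 1≤t t≤ = begin
      ∑ (partsB (suc f) (suc n) b) _
        ≡⟨ ∑-concatMap (λ j → map (j ∷_) (partsB f (suc n ∸ j) j)) (map suc (upTo (suc n ⊓ b))) _ ⟩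
      ∑ (map suc (upTo (suc n ⊓ b))) (λ j → ∑ (map (j ∷_) (partsB f (suc n ∸ j) j)) (λ λs → ⟦ λs ==ᴸ (t ∷ ν) ⟧))
        ≡⟨ ∑-cong (map suc (upTo (suc n ⊓ b))) (λ j → count-∷ j t ν (partsB f (suc n ∸ j) j)) ⟩
      ∑ (map suc (upTo (suc n ⊓ b))) (λ j → ⟦ j ≡ᵇ t ⟧ * ∑ (partsB f (suc n ∸ j) j) (λ μ → ⟦ μ ==ᴸ ν ⟧))
        ≡⟨ ∑-sucs-pick (suc n ⊓ b) t (λ j → ∑ (partsB f (suc n ∸ j) j) (λ μ → ⟦ μ ==ᴸ ν ⟧)) 1≤t t≤ ⟩
      ∑ (partsB f (suc n ∸ t) t) (λ μ → ⟦ μ ==ᴸ ν ⟧) ∎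
      where open ≡-Reasoning

    count-last-part : ∀ f t → 1 ≤ t → ∑ (partsB (suc f) t t) (λ λs → ⟦ λs ==ᴸ (t ∷ []) ⟧) ≡ 1
    count-last-part f (suc t) _ = begin
      ∑ (partsB (suc f) (suc t) (suc t)) (λ λs → ⟦ λs ==ᴸ (suc t ∷ []) ⟧)
        ≡⟨ count-first-part f t (suc t) (suc t) [] (s≤s z≤n) (≤-reflexive (sym (⊓-idem (suc t)))) ⟩
      ∑ (partsB f (suc t ∸ suc t) (suc t)) (λ μ → ⟦ μ ==ᴸ [] ⟧)
        ≡⟨ cong (λ r → ∑ (partsB f r (suc t)) (λ μ → ⟦ μ ==ᴸ [] ⟧)) (n∸n≡0 t) ⟩
      1 ∎
      where open ≡-Reasoning

  #partitions-≡-twoRow : ∀ N k → 1 ≤ N → k + k ≤ N → ∑ (partitions N) (λ λs → ⟦ λs ==ᴸ twoRow N k ⟧) ≡ 1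
  #partitions-≡-twoRow (suc n) zero _ _ = count-last-part n (suc n) (s≤s z≤n)
  #partitions-≡-twoRow (suc zero) (suc k) _ (s≤s 2k+1≤0) with () ← subst (_≤ 0) (+-suc k k) 2k+1≤0
  #partitions-≡-twoRow (suc (suc n)) (suc k) _ 2k+2≤N = begin
    ∑ (partitions N) (λ λs → ⟦ λs ==ᴸ (t ∷ suc k ∷ []) ⟧)
      ≡⟨ count-first-part (suc n) (suc n) N t (suc k ∷ []) 1≤t (subst (t ≤_) (sym (⊓-idem N)) (m∸n≤m N (suc k))) ⟩
    ∑ (partsB (suc n) (N ∸ t) t) (λ μ → ⟦ μ ==ᴸ (suc k ∷ []) ⟧)
      ≡⟨ cong (λ r → ∑ (partsB (suc n) r t) (λ μ → ⟦ μ ==ᴸ (suc k ∷ []) ⟧)) (m∸[m∸n]≡n k<N) ⟩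
    ∑ (partsB (suc n) (suc k) t) (λ μ → ⟦ μ ==ᴸ (suc k ∷ []) ⟧)
      ≡⟨ count-first-part n k t (suc k) [] (s≤s z≤n) (≤-reflexive (sym (m≤n⇒m⊓n≡m k<t))) ⟩
    ∑ (partsB n (suc k ∸ suc k) (suc k)) (λ μ → ⟦ μ ==ᴸ [] ⟧)
      ≡⟨ cong (λ r → ∑ (partsB n r (suc k)) (λ μ → ⟦ μ ==ᴸ [] ⟧)) (n∸n≡0 k) ⟩
    1 ∎
    where
    open ≡-Reasoning
    N = suc (suc n)
    t = N ∸ suc k
    k<N : suc k ≤ N
    k<N = m+n≤o⇒m≤o (suc k) 2k+2≤N
    k<t : suc k ≤ t
    k<t = m+n≤o⇒m≤o∸n (suc k) 2k+2≤N
    1≤t : 1 ≤ t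
    1≤t = ≤-trans (s≤s z≤n) k<t


module Ballots where

  open Sums
  open BooleanSubsets
  open SubsetMultisets
  open TwoRowCount
  open import Data.Nat using (ℕ; zero; suc; _+_)
  open import Data.Nat.Properties using (+-identityʳ; +-suc)
  open import Data.Bool using (Bool; true; false; _∧_; not; if_then_else_)
  open import Data.Vec using (Vec; []; _∷_)
  open import Data.Fin.Subset using (Subset)
  open import Data.List using (List; []; _∷_; [_]; _++_; map)
  open import Data.Product using (Σ-syntax; _×_; _,_)
  open import Relation.Binary.PropositionalEquality hiding ([_])
  open import Defs using (compAux; comp)

  -- ballots h k n: the paths of n steps starting at height h that never go below 0,
  -- with k down-steps (true) and the other steps up (false). For h = 0 a path of
  -- length N is a standard Young tableau of shape (N - k, k), the letter i being
  -- in the second row iff the i-th step is down.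
  mutual
    ballots : ℕ → ℕ → (n : ℕ) → List (Vec Bool n)
    ballots h k zero = ballots₀ k
    ballots h k (suc n) = map (false ∷_) (ballots (suc h) k n) ++ ballots↓ h k n

    ballots₀ : ℕ → List (Vec Bool zero)
    ballots₀ zero = [ [] ]
    ballots₀ (suc k) = []

    ballots↓ : ℕ → ℕ → (n : ℕ) → List (Vec Bool (suc n))
    ballots↓ (suc h) (suc k) n = map (true ∷_) (ballots h k n)
    ballots↓ zero k n = []
    ballots↓ (suc h) zero n = []

  descents : ∀ {n} → Vec Bool (suc n) → Subset n
  descents (x ∷ []) = []
  descents (x ∷ y ∷ w) = (not x ∧ y) ∷ descents (y ∷ w)

  descentSets : (n k : ℕ) → List (Subset n)
  descentSets n k = map descents (ballots 0 k (suc n))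

  ∑-ballots : ∀ h k n (f : Vec Bool (suc n) → ℕ) →
    ∑ (ballots h k (suc n)) f ≡ ∑ (ballots (suc h) k n) (λ w → f (false ∷ w)) + ∑ (ballots↓ h k n) f
  ∑-ballots h k n f = trans (∑-++ (map (false ∷_) (ballots (suc h) k n)) (ballots↓ h k n) f)
                            (cong (_+ ∑ (ballots↓ h k n) f) (∑-map (false ∷_) (ballots (suc h) k n) f))

  ∑-ballots↓ : ∀ h k n (f : Vec Bool (suc n) → ℕ) →
    ∑ (ballots↓ (suc h) (suc k) n) f ≡ ∑ (ballots h k n) (λ w → f (true ∷ w))
  ∑-ballots↓ h k n f = ∑-map (true ∷_) (ballots h k n) f

  descents-sparse : ∀ {n} (w : Vec Bool (suc n)) → sparseᵇ (descents w) ≡ true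
  descents-sparse (x ∷ []) = refl
  descents-sparse (x ∷ y ∷ []) = refl
  descents-sparse (x ∷ true ∷ z ∷ w) rewrite descents-sparse (true ∷ z ∷ w) with x
  ... | true = refl
  ... | false = refl
  descents-sparse (x ∷ false ∷ z ∷ w) rewrite descents-sparse (false ∷ z ∷ w) with x
  ... | true = refl
  ... | false = refl

  mult-descentSets-nonsparse : ∀ n k (J : Subset n) → sparseᵇ J ≡ false → mult (descentSets n k) J ≡ 0
  mult-descentSets-nonsparse n k J J-not-sparse =
    trans (∑-map descents (ballots 0 k (suc n)) _) (∑-zero (ballots 0 k (suc n)) not-a-descent-set)
    where
    not-a-descent-set : ∀ w → ⟦ descents w == J ⟧ ≡ 0
    not-a-descent-set w with descents w == J in w==J
    ... | true with () ← trans (sym (descents-sparse w)) (trans (cong sparseᵇ (==⇒≡ (descents w) J w==J)) J-not-sparse)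
    ... | false = refl

  compAux-head : ∀ {n} c (K : Subset n) → Σ[ a ∈ ℕ ] Σ[ α ∈ List ℕ ] compAux c K ≡ a ∷ α × compAux (suc c) K ≡ suc a ∷ α
  compAux-head c [] = c , [] , refl , refl
  compAux-head c (true ∷ K) = c , compAux 1 K , refl , refl
  compAux-head c (false ∷ K) = compAux-head (suc c) K

  #desc⊆ : ∀ {n} → ℕ → Bool → ℕ → Subset n → ℕ
  #desc⊆ {n} h x k K = ∑ (ballots h k n) (λ w → ⟦ descents (x ∷ w) ⊆ᵇ K ⟧)

  #desc⊆↓ : ∀ {n} → ℕ → ℕ → Subset n → ℕ
  #desc⊆↓ (suc h) (suc k) K = #desc⊆ h true k K
  #desc⊆↓ zero k K = 0
  #desc⊆↓ (suc h) zero K = 0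

  #desc⊆-true∷ : ∀ {n} h k κ (K : Subset n) → #desc⊆ h true k (κ ∷ K) ≡ #desc⊆ (suc h) false k K + #desc⊆↓ h k K
  #desc⊆-true∷ {n} h k κ K = trans (∑-ballots h k n _) (cong (#desc⊆ (suc h) false k K +_) (step↓ h k))
    where
    step↓ : ∀ h k → ∑ (ballots↓ h k n) (λ w → ⟦ descents (true ∷ w) ⊆ᵇ (κ ∷ K) ⟧) ≡ #desc⊆↓ h k K
    step↓ (suc h) (suc k) = ∑-ballots↓ h k n _
    step↓ zero k = refl
    step↓ (suc h) zero = refl

  #desc⊆-false∷ : ∀ {n} h k κ (K : Subset n) →
    #desc⊆ h false k (κ ∷ K) ≡ #desc⊆ (suc h) false k K + (if κ then #desc⊆↓ h k K else 0)
  #desc⊆-false∷ {n} h k κ K = trans (∑-ballots h k n _) (cong (#desc⊆ (suc h) false k K +_) (step↓ h k κ))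
    where
    step↓ : ∀ h k κ → ∑ (ballots↓ h k n) (λ w → ⟦ descents (false ∷ w) ⊆ᵇ (κ ∷ K) ⟧) ≡ (if κ then #desc⊆↓ h k K else 0)
    step↓ (suc h) (suc k) true = ∑-ballots↓ h k n _
    step↓ (suc h) (suc k) false = trans (∑-ballots↓ h k n _) (∑-zero (ballots h k n) (λ _ → refl))
    step↓ zero k κ = if-zero κ
      where
      if-zero : ∀ κ → 0 ≡ (if κ then 0 else 0)
      if-zero true = refl
      if-zero false = refl
    step↓ (suc h) zero true = refl
    step↓ (suc h) zero false = refl

  -- Standardisation: cut at the positions in K, a word has no descent inside a run,
  -- so each run is true…true false…false, the copies of one letter in rows 2 and 1.
  mutual
    #desc⊆-true≡K₂ : ∀ {n} h k (K : Subset n) → #desc⊆ h true k K ≡ K₂ h k (compAux 0 K)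
    #desc⊆-true≡K₂ h zero [] = refl
    #desc⊆-true≡K₂ h (suc k) [] = refl
    #desc⊆-true≡K₂ h k (κ ∷ K) with compAux-head 0 K
    ... | a , α , K≡a∷α , K≡1+a∷α = begin
      #desc⊆ h true k (κ ∷ K)                             ≡⟨ #desc⊆-true∷ h k κ K ⟩
      #desc⊆ (suc h) false k K + #desc⊆↓ h k K            ≡⟨ cong₂ _+_ row₁ (lower-row h k) ⟩
      K₂ (suc h + a) k α + K₂-place↓ h k a α              ≡⟨ recompose κ ⟨
      K₂ h k (compAux 0 (κ ∷ K))                          ∎
      where
      open ≡-Reasoning
      row₁ : #desc⊆ (suc h) false k K ≡ K₂ (suc h + a) k α
      row₁ = trans (#desc⊆-false≡K₂-row₁ (suc h) k K) (cong (K₂-row₁ (suc h) k) K≡a∷α)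
      lower-row : ∀ h k → #desc⊆↓ h k K ≡ K₂-place↓ h k a α
      lower-row (suc h) (suc k) = trans (#desc⊆-true≡K₂ h k K) (cong (K₂ h k) K≡a∷α)
      lower-row zero k = refl
      lower-row (suc h) zero = refl
      recompose : ∀ κ → K₂ h k (compAux 0 (κ ∷ K)) ≡ K₂ (suc h + a) k α + K₂-place↓ h k a α
      recompose true rewrite K≡1+a∷α | +-suc h a = refl
      recompose false rewrite K≡1+a∷α | +-suc h a = refl

    #desc⊆-false≡K₂-row₁ : ∀ {n} h k (K : Subset n) → #desc⊆ h false k K ≡ K₂-row₁ h k (compAux 0 K)
    #desc⊆-false≡K₂-row₁ h zero [] = refl
    #desc⊆-false≡K₂-row₁ h (suc k) [] = refl
    #desc⊆-false≡K₂-row₁ h k (true ∷ K) with compAux-head 0 K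
    ... | a , α , K≡a∷α , K≡1+a∷α = begin
      #desc⊆ h false k (true ∷ K)                         ≡⟨ #desc⊆-false∷ h k true K ⟩
      #desc⊆ (suc h) false k K + #desc⊆↓ h k K            ≡⟨ cong₂ _+_ row₁ (lower-row h k) ⟩
      K₂ (suc h + a) k α + K₂-place↓ h k a α              ≡⟨ recompose ⟨
      K₂-row₁ h k (compAux 0 (true ∷ K))                  ∎
      where
      open ≡-Reasoning
      row₁ : #desc⊆ (suc h) false k K ≡ K₂ (suc h + a) k α
      row₁ = trans (#desc⊆-false≡K₂-row₁ (suc h) k K) (cong (K₂-row₁ (suc h) k) K≡a∷α)
      lower-row : ∀ h k → #desc⊆↓ h k K ≡ K₂-place↓ h k a α
      lower-row (suc h) (suc k) = trans (#desc⊆-true≡K₂ h k K) (cong (K₂ h k) K≡a∷α)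
      lower-row zero k = refl
      lower-row (suc h) zero = refl
      recompose : K₂-row₁ h k (compAux 0 (true ∷ K)) ≡ K₂ (suc h + a) k α + K₂-place↓ h k a α
      recompose rewrite K≡1+a∷α | +-identityʳ h | +-suc h a = refl
    #desc⊆-false≡K₂-row₁ h k (false ∷ K) with compAux-head 0 K
    ... | a , α , K≡a∷α , K≡1+a∷α = begin
      #desc⊆ h false k (false ∷ K)       ≡⟨ #desc⊆-false∷ h k false K ⟩
      #desc⊆ (suc h) false k K + 0       ≡⟨ +-identityʳ _ ⟩
      #desc⊆ (suc h) false k K           ≡⟨ #desc⊆-false≡K₂-row₁ (suc h) k K ⟩
      K₂-row₁ (suc h) k (compAux 0 K)    ≡⟨ cong (K₂-row₁ (suc h) k) K≡a∷α ⟩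
      K₂ (suc h + a) k α                 ≡⟨ recompose ⟨
      K₂-row₁ h k (compAux 0 (false ∷ K)) ∎
      where
      open ≡-Reasoning
      recompose : K₂-row₁ h k (compAux 0 (false ∷ K)) ≡ K₂ (suc h + a) k α
      recompose rewrite K≡1+a∷α | +-suc h a = refl

  #⊆-descentSets : ∀ {n} k (K : Subset n) → #⊆ (descentSets n k) K ≡ K₂ 0 k (comp K)
  #⊆-descentSets {n} k K with compAux-head 0 K
  ... | a , α , K≡a∷α , K≡1+a∷α = begin
    #⊆ (descentSets n k) K                              ≡⟨ ∑-map descents (ballots 0 k (suc n)) _ ⟩
    ∑ (ballots 0 k (suc n)) (λ w → ⟦ descents w ⊆ᵇ K ⟧) ≡⟨ ∑-ballots 0 k n _ ⟩
    #desc⊆ 1 false k K + 0                              ≡⟨ +-identityʳ _ ⟩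
    #desc⊆ 1 false k K                                  ≡⟨ #desc⊆-false≡K₂-row₁ 1 k K ⟩
    K₂-row₁ 1 k (compAux 0 K)                           ≡⟨ cong (K₂-row₁ 1 k) K≡a∷α ⟩
    K₂ (suc a) k α                                      ≡⟨ +-identityʳ _ ⟨
    K₂ (suc a) k α + 0                                  ≡⟨ cong (K₂ 0 k) K≡1+a∷α ⟨
    K₂ 0 k (comp K)                                     ∎
    where open ≡-Reasoning


module BallotSupersets where

  open Sums
  open BooleanSubsets
  open SubsetMultisets
  open Ballots
  open import Data.Nat using (ℕ; zero; suc; _+_; _∸_; _≤_; _<_; s≤s; _≤?_)
  open import Data.Nat.Properties
  open import Data.Bool using (Bool; true; false)
  open import Data.Vec using (Vec; []; _∷_)
  open import Data.Fin.Subset using (Subset; ∣_∣)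
  open import Relation.Binary.PropositionalEquality
  open import Relation.Nullary using (yes; no)

  #ballots : ℕ → ℕ → ℕ → ℕ
  #ballots h k n = ∑ (ballots h k n) (λ _ → 1)

  #ballots↓ : ℕ → ℕ → ℕ → ℕ
  #ballots↓ (suc h) (suc k) n = #ballots h k n
  #ballots↓ zero k n = 0
  #ballots↓ (suc h) zero n = 0

  #desc⊇ : ℕ → ℕ → (n : ℕ) → Subset n → ℕ
  #desc⊇ h k n J = ∑ (ballots h k (suc n)) (λ w → ⟦ J ⊆ᵇ descents w ⟧)

  #desc⊇↓ : ℕ → ℕ → (n : ℕ) → Subset n → ℕ
  #desc⊇↓ (suc h) (suc k) n J = #desc⊇ h k n J
  #desc⊇↓ zero k n J = 0
  #desc⊇↓ (suc h) zero n J = 0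

  #ballots-suc : ∀ h k n → #ballots h k (suc n) ≡ #ballots (suc h) k n + #ballots↓ h k n
  #ballots-suc h k n = trans (∑-ballots h k n (λ _ → 1)) (cong (#ballots (suc h) k n +_) (step↓ h k))
    where
    step↓ : ∀ h k → ∑ (ballots↓ h k n) (λ _ → 1) ≡ #ballots↓ h k n
    step↓ (suc h) (suc k) = ∑-ballots↓ h k n _
    step↓ zero k = refl
    step↓ (suc h) zero = refl

  false∷⊆ᵇdescents : ∀ {n} (J : Subset n) x (w : Vec Bool (suc n)) →
    (false ∷ J) ⊆ᵇ descents (x ∷ w) ≡ J ⊆ᵇ descents w
  false∷⊆ᵇdescents J x (y ∷ w) = refl

  #desc⊇-false∷ : ∀ h k n (J : Subset n) → #desc⊇ h k (suc n) (false ∷ J) ≡ #desc⊇ (suc h) k n J + #desc⊇↓ h k n J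
  #desc⊇-false∷ h k n J = trans (∑-ballots h k (suc n) _)
    (cong₂ _+_ (∑-cong (ballots (suc h) k (suc n)) (λ w → cong ⟦_⟧ (false∷⊆ᵇdescents J false w))) (step↓ h k))
    where
    step↓ : ∀ h k → ∑ (ballots↓ h k (suc n)) (λ w → ⟦ (false ∷ J) ⊆ᵇ descents w ⟧) ≡ #desc⊇↓ h k n J
    step↓ (suc h) (suc k) = trans (∑-ballots↓ h k (suc n) _)
                                  (∑-cong (ballots h k (suc n)) (λ w → cong ⟦_⟧ (false∷⊆ᵇdescents J true w)))
    step↓ zero k = refl
    step↓ (suc h) zero = refl

  #desc⊇-true∷-up : ∀ h k n (J : Subset n) →
    #desc⊇ h k (suc n) (true ∷ J) ≡ ∑ (ballots (suc h) k (suc n)) (λ w → ⟦ (true ∷ J) ⊆ᵇ descents (false ∷ w) ⟧)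
  #desc⊇-true∷-up h k n J = trans (∑-ballots h k (suc n) _) (trans (cong (first-up +_) (step↓ h k)) (+-identityʳ _))
    where
    first-up = ∑ (ballots (suc h) k (suc n)) (λ w → ⟦ (true ∷ J) ⊆ᵇ descents (false ∷ w) ⟧)
    no-descent : ∀ (w : Vec Bool (suc n)) → ⟦ (true ∷ J) ⊆ᵇ descents (true ∷ w) ⟧ ≡ 0
    no-descent (y ∷ w) = refl
    step↓ : ∀ h k → ∑ (ballots↓ h k (suc n)) (λ w → ⟦ (true ∷ J) ⊆ᵇ descents w ⟧) ≡ 0
    step↓ (suc h) (suc k) = trans (∑-ballots↓ h k (suc n) _) (∑-zero (ballots h k (suc n)) no-descent)
    step↓ zero k = refl
    step↓ (suc h) zero = refl

  #desc⊇-true∷ : ∀ h k n (J : Subset n) →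
    #desc⊇ h (suc k) (suc n) (true ∷ J) ≡ ∑ (ballots h k n) (λ w → ⟦ J ⊆ᵇ descents (true ∷ w) ⟧)
  #desc⊇-true∷ h k n J = trans (#desc⊇-true∷-up h (suc k) n J) (trans (∑-ballots (suc h) (suc k) n _)
    (cong₂ _+_ (∑-zero (ballots (suc (suc h)) (suc k) n) (λ _ → refl)) (∑-ballots↓ h k n _)))

  #desc⊇-true∷-zero : ∀ h n (J : Subset n) → #desc⊇ h 0 (suc n) (true ∷ J) ≡ 0
  #desc⊇-true∷-zero h n J = trans (#desc⊇-true∷-up h 0 n J) (trans (∑-ballots (suc h) 0 n _)
    (trans (+-identityʳ _) (∑-zero (ballots (suc (suc h)) 0 n) (λ _ → refl))))

  -- A descent at i forces the steps i, i+1 to be up, down; these cancel, so the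
  -- paths with descents at a sparse J are the paths of length 2∣J∣ shorter.
  mutual
    #desc⊇-sparse : ∀ h k n (J : Subset n) → sparseᵇ J ≡ true →
      #desc⊇ h (∣ J ∣ + k) n J ≡ #ballots h k (suc n ∸ (∣ J ∣ + ∣ J ∣))
    #desc⊇-sparse h k zero [] _ = ∑-cong (ballots h k 1) (λ { (x ∷ []) → refl })
    #desc⊇-sparse h k (suc n) (false ∷ J) J-sparse = begin
      #desc⊇ h (j + k) (suc n) (false ∷ J)               ≡⟨ #desc⊇-false∷ h (j + k) n J ⟩
      #desc⊇ (suc h) (j + k) n J + #desc⊇↓ h (j + k) n J ≡⟨ cong₂ _+_ (#desc⊇-sparse (suc h) k n J tail-sparse) (step↓ h k) ⟩
      #ballots (suc h) k r + #ballots↓ h k r             ≡⟨ #ballots-suc h k r ⟨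
      #ballots h k (suc r)                               ≡⟨ cong (#ballots h k) (+-∸-assoc 1 (sparse⇒∣∣+∣∣≤ J tail-sparse)) ⟨
      #ballots h k (suc (suc n) ∸ (j + j))               ∎
      where
      open ≡-Reasoning
      j = ∣ J ∣
      r = suc n ∸ (j + j)
      tail-sparse = sparseᵇ-tail false J J-sparse
      too-few-downs : ∀ h i → i ≡ j → #desc⊇↓ (suc h) i n J ≡ 0
      too-few-downs h zero _ = refl
      too-few-downs h (suc i) 1+i≡j = #desc⊇-vanish h i n J tail-sparse (subst (i <_) 1+i≡j ≤-refl)
      step↓ : ∀ h k → #desc⊇↓ h (j + k) n J ≡ #ballots↓ h k r
      step↓ zero k = refl
      step↓ (suc h) (suc k) rewrite +-suc j k = #desc⊇-sparse h k n J tail-sparse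
      step↓ (suc h) zero rewrite +-identityʳ j = too-few-downs h j refl
    #desc⊇-sparse h k (suc zero) (true ∷ []) _ =
      trans (#desc⊇-true∷ h k zero []) (∑-cong (ballots h k 0) (λ { [] → refl }))
    #desc⊇-sparse h k (suc (suc n)) (true ∷ false ∷ J) J-sparse = begin
      #desc⊇ h (suc (j + k)) (suc (suc n)) (true ∷ false ∷ J)
        ≡⟨ #desc⊇-true∷ h (j + k) (suc n) (false ∷ J) ⟩
      ∑ (ballots h (j + k) (suc n)) (λ w → ⟦ (false ∷ J) ⊆ᵇ descents (true ∷ w) ⟧)
        ≡⟨ ∑-cong (ballots h (j + k) (suc n)) (λ w → cong ⟦_⟧ (false∷⊆ᵇdescents J true w)) ⟩
      #desc⊇ h (j + k) n J
        ≡⟨ #desc⊇-sparse h k n J (sparseᵇ-tail false J (sparseᵇ-tail true (false ∷ J) J-sparse)) ⟩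
      #ballots h k (suc n ∸ (j + j))
        ≡⟨ cong (λ z → #ballots h k (suc (suc (suc n)) ∸ suc z)) (+-suc j j) ⟨
      #ballots h k (suc (suc (suc n)) ∸ (suc j + suc j)) ∎
      where
      open ≡-Reasoning
      j = ∣ J ∣

    #desc⊇-vanish : ∀ h k n (J : Subset n) → sparseᵇ J ≡ true → k < ∣ J ∣ → #desc⊇ h k n J ≡ 0
    #desc⊇-vanish h k (suc n) (false ∷ J) J-sparse k<∣J∣ = trans (#desc⊇-false∷ h k n J)
      (cong₂ _+_ (#desc⊇-vanish (suc h) k n J (sparseᵇ-tail false J J-sparse) k<∣J∣) (step↓ h k k<∣J∣))
      where
      step↓ : ∀ h k → k < ∣ J ∣ → #desc⊇↓ h k n J ≡ 0
      step↓ zero k _ = refl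
      step↓ (suc h) (suc k) 1+k<∣J∣ = #desc⊇-vanish h k n J (sparseᵇ-tail false J J-sparse) (<-trans (n<1+n k) 1+k<∣J∣)
      step↓ (suc h) zero _ = refl
    #desc⊇-vanish h zero (suc n) (true ∷ J) _ _ = #desc⊇-true∷-zero h n J
    #desc⊇-vanish h (suc k) (suc (suc n)) (true ∷ false ∷ J) J-sparse (s≤s k<∣J∣) =
      trans (#desc⊇-true∷ h k (suc n) (false ∷ J))
        (trans (∑-cong (ballots h k (suc n)) (λ w → cong ⟦_⟧ (false∷⊆ᵇdescents J true w)))
               (#desc⊇-vanish h k n J (sparseᵇ-tail false J (sparseᵇ-tail true (false ∷ J) J-sparse)) k<∣J∣))
    #desc⊇-vanish h (suc k) (suc (suc n)) (true ∷ true ∷ J) () _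

  #desc⊇-∣∣ : ∀ h k n (J J′ : Subset n) → sparseᵇ J ≡ true → sparseᵇ J′ ≡ true → ∣ J ∣ ≡ ∣ J′ ∣ →
    #desc⊇ h k n J ≡ #desc⊇ h k n J′
  #desc⊇-∣∣ h k n J J′ J-sparse J′-sparse ∣J∣≡∣J′∣ with ∣ J ∣ ≤? k
  ... | yes ∣J∣≤k = begin
    #desc⊇ h k n J                                       ≡⟨ cong (λ z → #desc⊇ h z n J) (m+[n∸m]≡n ∣J∣≤k) ⟨
    #desc⊇ h (∣ J ∣ + (k ∸ ∣ J ∣)) n J                   ≡⟨ #desc⊇-sparse h (k ∸ ∣ J ∣) n J J-sparse ⟩
    #ballots h (k ∸ ∣ J ∣) (suc n ∸ (∣ J ∣ + ∣ J ∣))     ≡⟨ cong (λ z → #ballots h (k ∸ z) (suc n ∸ (z + z))) ∣J∣≡∣J′∣ ⟩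
    #ballots h (k ∸ ∣ J′ ∣) (suc n ∸ (∣ J′ ∣ + ∣ J′ ∣))  ≡⟨ #desc⊇-sparse h (k ∸ ∣ J′ ∣) n J′ J′-sparse ⟨
    #desc⊇ h (∣ J′ ∣ + (k ∸ ∣ J′ ∣)) n J′                ≡⟨ cong (λ z → #desc⊇ h z n J′) (m+[n∸m]≡n (subst (_≤ k) ∣J∣≡∣J′∣ ∣J∣≤k)) ⟩
    #desc⊇ h k n J′                                      ∎
    where open ≡-Reasoning
  ... | no ∣J∣≰k = trans (#desc⊇-vanish h k n J J-sparse (≰⇒> ∣J∣≰k))
                         (sym (#desc⊇-vanish h k n J′ J′-sparse (subst (k <_) ∣J∣≡∣J′∣ (≰⇒> ∣J∣≰k))))

  #⊇-descentSets-sparse : ∀ n k (J J′ : Subset n) → sparseᵇ J ≡ true → sparseᵇ J′ ≡ true → ∣ J ∣ ≡ ∣ J′ ∣ →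
    #⊇ (descentSets n k) J ≡ #⊇ (descentSets n k) J′
  #⊇-descentSets-sparse n k J J′ J-sparse J′-sparse ∣J∣≡∣J′∣ = begin
    #⊇ (descentSets n k) J  ≡⟨ ∑-map descents (ballots 0 k (suc n)) _ ⟩
    #desc⊇ 0 k n J          ≡⟨ #desc⊇-∣∣ 0 k n J J′ J-sparse J′-sparse ∣J∣≡∣J′∣ ⟩
    #desc⊇ 0 k n J′         ≡⟨ ∑-map descents (ballots 0 k (suc n)) _ ⟨
    #⊇ (descentSets n k) J′ ∎
    where open ≡-Reasoning


module BallotOdds where

  open Sums
  open BooleanSubsets
  open SubsetMultisets
  open Ballots
  open import Data.Nat using (ℕ; zero; suc; _+_; _*_; _≤_; s≤s; _<ᵇ_; _≡ᵇ_)
  open import Data.Nat.Properties using (+-identityʳ; +-suc; ≤-pred)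
  open import Data.Bool using (Bool; true; false; _∧_)
  open import Data.Bool.Properties using (∧-zeroʳ)
  open import Data.Vec using (Vec; []; _∷_; tabulate; replicate)
  open import Data.Vec.Properties using (tabulate-cong)
  open import Data.Fin using (Fin; toℕ; zero; suc)
  open import Data.Fin.Subset using (Subset; ∣_∣)
  open import Data.Product using (_×_; _,_)
  open import Relation.Binary.PropositionalEquality
  open import Defs using (odds; even?)

  tabulate-false : ∀ n (g : Fin n → Bool) → (∀ i → g i ≡ false) → tabulate g ≡ replicate n false
  tabulate-false zero g _ = refl
  tabulate-false (suc n) g g≗false = cong₂ _∷_ (g≗false zero) (tabulate-false n (λ i → g (suc i)) (λ i → g≗false (suc i)))

  odds-zero : ∀ n → odds n 0 ≡ replicate n false
  odds-zero n = tabulate-false n _ (λ i → ∧-zeroʳ (even? (toℕ i)))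

  odds-suc : ∀ n l → odds (suc (suc n)) (suc l) ≡ true ∷ false ∷ odds n l
  odds-suc n l = cong (λ v → true ∷ false ∷ v) (tabulate-cong shift)
    where
    shift : ∀ i → even? (toℕ i) ∧ (suc (suc (toℕ i)) <ᵇ 2 * suc l) ≡ even? (toℕ i) ∧ (toℕ i <ᵇ 2 * l)
    shift i rewrite +-suc l (l + 0) = refl

  private
    2+l+l≤ : ∀ {n l} → suc l + suc l ≤ suc (suc (suc n)) → l + l ≤ suc n
    2+l+l≤ {n} {l} bound = ≤-pred (≤-pred (subst (_≤ suc (suc (suc n))) (cong suc (+-suc l l)) bound))

  odds-sparse-∣∣ : ∀ n l → l + l ≤ suc n → sparseᵇ (odds n l) ≡ true × ∣ odds n l ∣ ≡ l
  odds-sparse-∣∣ n zero _ rewrite odds-zero n = all-false n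
    where
    all-false : ∀ n → sparseᵇ (replicate n false) ≡ true × ∣ replicate n false ∣ ≡ 0
    all-false zero = refl , refl
    all-false (suc n) with all-false n
    ... | sparse , empty = trans (sparseᵇ-false∷ (replicate n false)) sparse , empty
  odds-sparse-∣∣ zero (suc l) (s≤s bound) with () ← subst (_≤ 0) (+-suc l l) bound
  odds-sparse-∣∣ (suc zero) (suc zero) _ = refl , refl
  odds-sparse-∣∣ (suc zero) (suc (suc l)) (s≤s bound) with s≤s () ← subst (_≤ 1) (+-suc (suc l) (suc l)) bound
  odds-sparse-∣∣ (suc (suc n)) (suc l) bound with odds-sparse-∣∣ n l (2+l+l≤ bound)
  ... | sparse , ∣odds∣≡l = subst (λ v → sparseᵇ v ≡ true × ∣ v ∣ ≡ suc l) (sym (odds-suc n l))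
                                  (trans (sparseᵇ-false∷ (odds n l)) sparse , cong suc ∣odds∣≡l)

  #desc≡ : ℕ → (n : ℕ) → Subset n → ℕ
  #desc≡ k n P = ∑ (ballots 1 k n) (λ w → ⟦ descents (false ∷ w) == P ⟧)

  mult-descentSets : ∀ n k (P : Subset n) → mult (descentSets n k) P ≡ #desc≡ k n P
  mult-descentSets n k P = trans (∑-map descents (ballots 0 k (suc n)) _) (trans (∑-ballots 0 k n _) (+-identityʳ _))

  #desc≡-empty : ∀ h k n → ∑ (ballots h k n) (λ w → ⟦ descents (false ∷ w) == replicate n false ⟧) ≡ ⟦ k ≡ᵇ 0 ⟧
  #desc≡-empty h zero zero = refl
  #desc≡-empty h (suc k) zero = refl
  #desc≡-empty h k (suc n) = trans (∑-ballots h k n _) (trans (cong₂ _+_ (#desc≡-empty (suc h) k n) (step↓ h k)) (+-identityʳ _))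
    where
    step↓ : ∀ h k → ∑ (ballots↓ h k n) (λ w → ⟦ descents (false ∷ w) == replicate (suc n) false ⟧) ≡ 0
    step↓ (suc h) (suc k) = trans (∑-ballots↓ h k n _) (∑-zero (ballots h k n) (λ _ → refl))
    step↓ zero k = refl
    step↓ (suc h) zero = refl

  -- The only tableau of shape (N-l, l) with descent set {1,3,…,2l-1} is the one whose
  -- first 2l letters alternate between the rows.
  #desc≡-odds : ∀ k n l → l + l ≤ suc n → #desc≡ k n (odds n l) ≡ ⟦ k ≡ᵇ l ⟧
  #desc≡-odds k n zero _ rewrite odds-zero n = #desc≡-empty 1 k n
  #desc≡-odds k zero (suc l) (s≤s bound) with () ← subst (_≤ 0) (+-suc l l) bound
  #desc≡-odds k (suc zero) (suc zero) _ = trans (∑-ballots 1 k 0 _) (by-k k)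
    where
    by-k : ∀ k → ∑ (ballots 2 k 0) (λ w → ⟦ descents (false ∷ false ∷ w) == (true ∷ []) ⟧)
               + ∑ (ballots↓ 1 k 0) (λ w → ⟦ descents (false ∷ w) == (true ∷ []) ⟧) ≡ ⟦ k ≡ᵇ 1 ⟧
    by-k zero = refl
    by-k (suc zero) = refl
    by-k (suc (suc k)) = refl
  #desc≡-odds k (suc zero) (suc (suc l)) (s≤s bound) with s≤s () ← subst (_≤ 1) (+-suc (suc l) (suc l)) bound
  #desc≡-odds k (suc (suc n)) (suc l) bound rewrite odds-suc n l = begin
    #desc≡ k (suc (suc n)) (true ∷ false ∷ odds n l)                    ≡⟨ ∑-ballots 1 k (suc n) _ ⟩
    ∑ (ballots 2 k (suc n)) (λ _ → 0) + second-step-down k              ≡⟨ cong (_+ second-step-down k) (∑-zero (ballots 2 k (suc n)) (λ _ → refl)) ⟩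
    second-step-down k                                                  ≡⟨ by-k k ⟩
    ⟦ k ≡ᵇ suc l ⟧                                                      ∎
    where
    open ≡-Reasoning
    second-step-down : ℕ → ℕ
    second-step-down k = ∑ (ballots↓ 1 k (suc n)) (λ w → ⟦ descents (false ∷ w) == (true ∷ false ∷ odds n l) ⟧)
    peel : ∀ (w : Vec Bool (suc n)) → ⟦ descents (false ∷ true ∷ w) == (true ∷ false ∷ odds n l) ⟧ ≡ ⟦ descents w == odds n l ⟧
    peel (x ∷ w) = refl
    by-k : ∀ k → second-step-down k ≡ ⟦ k ≡ᵇ suc l ⟧
    by-k zero = refl
    by-k (suc k) = begin
      second-step-down (suc k)                                      ≡⟨ ∑-ballots↓ 0 k (suc n) _ ⟩
      ∑ (ballots 0 k (suc n)) (λ w → ⟦ descents (false ∷ true ∷ w) == (true ∷ false ∷ odds n l) ⟧)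
                                                                    ≡⟨ ∑-cong (ballots 0 k (suc n)) peel ⟩
      ∑ (ballots 0 k (suc n)) (λ w → ⟦ descents w == odds n l ⟧)    ≡⟨ ∑-map descents (ballots 0 k (suc n)) _ ⟨
      mult (descentSets n k) (odds n l)                             ≡⟨ mult-descentSets n k (odds n l) ⟩
      #desc≡ k n (odds n l)                                         ≡⟨ #desc≡-odds k n l (2+l+l≤ bound) ⟩
      ⟦ k ≡ᵇ l ⟧                                                    ∎

  mult-descentSets-odds : ∀ n k l → l + l ≤ suc n → mult (descentSets n k) (odds n l) ≡ ⟦ k ≡ᵇ l ⟧
  mult-descentSets-odds n k l bound = trans (mult-descentSets n k (odds n l)) (#desc≡-odds k n l bound)


module Expansion where

  open Sums
  open BooleanSubsets
  open SubsetMultisets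
  open TwoRowCount
  open TwoRowSymmetry using (K₂-↭)
  open Ballots
  open BallotSupersets
  open BallotOdds
  open TwoRowKostka using (kostka≡K₂)
  open TwoRowPartitions
  open IntegerSums
  open import Defs
  open import Data.Nat using (ℕ; zero; suc; _+_; _*_; _∸_; _≤_; _<_; z≤n; s≤s; _≡ᵇ_; ⌊_/2⌋)
  open import Data.Nat.Properties
  open import Data.Nat.ListAction using (sum)
  open import Data.Bool using (Bool; true; false)
  open import Data.Bool.Properties using () renaming (_≟_ to _≟B_)
  open import Data.Vec using ([]; _∷_)
  open import Data.Vec.Properties using (≡-dec)
  open import Data.List using (List; _++_; map; concatMap; concat; replicate; upTo; allFin)
  open import Data.List.Membership.Propositional.Properties using (∈-allFin)
  open import Data.Fin using (Fin)
  open import Data.Fin.Subset using (Subset; ∣_∣)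
  open import Data.Fin.Subset.Properties using (_⊆?_)
  open import Data.Integer using (ℤ; +_)
  open import Data.Product using (Σ; _×_; _,_; proj₁; proj₂)
  open import Relation.Binary.PropositionalEquality
  open import Relation.Nullary using (does; contradiction)
  open import Relation.Unary using (Decidable)

  ≤⌊/2⌋⇒+≤ : ∀ N k → k ≤ ⌊ N /2⌋ → k + k ≤ N
  ≤⌊/2⌋⇒+≤ N zero _ = z≤n
  ≤⌊/2⌋⇒+≤ (suc (suc N)) (suc k) (s≤s k≤⌊N/2⌋) =
    s≤s (subst (_≤ suc N) (sym (+-suc k k)) (s≤s (≤⌊/2⌋⇒+≤ N k k≤⌊N/2⌋)))

  +≤⇒≤⌊/2⌋ : ∀ N k → k + k ≤ N → k ≤ ⌊ N /2⌋
  +≤⇒≤⌊/2⌋ N zero _ = z≤n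
  +≤⇒≤⌊/2⌋ (suc zero) (suc k) (s≤s 2k+1≤0) with () ← subst (_≤ 0) (+-suc k k) 2k+1≤0
  +≤⇒≤⌊/2⌋ (suc (suc N)) (suc k) (s≤s 2k+1≤N+1) =
    s≤s (+≤⇒≤⌊/2⌋ N k (≤-pred (subst (_≤ suc N) (+-suc k k) 2k+1≤N+1)))

  sum-compAux : ∀ {n} c (K : Subset n) → sum (compAux c K) ≡ c + n
  sum-compAux c [] = refl
  sum-compAux c (true ∷ K) = cong (λ z → c + z) (sum-compAux 1 K)
  sum-compAux {suc n} c (false ∷ K) = trans (sum-compAux (suc c) K) (sym (+-suc c n))

  module _ (n m : ℕ) (D : Fin m → Subset n) where

    N : ℕ
    N = suc n

    ks : List ℕ
    ks = upTo (suc ⌊ N /2⌋)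

    𝒜 : List (Subset n)
    𝒜 = map D (allFin m)

    -- The descent sets of c k copies of each SYT((N-k, k)), k ∈ ks: a multiset whose
    -- quasisymmetric generating function is Σₖ c k s_{(N-k,k)}.
    tableaux : (ℕ → ℕ) → List (Subset n)
    tableaux c = concatMap (λ k → concat (replicate (c k) (descentSets n k))) ks

    ∑-tableaux : ∀ c f → ∑ (tableaux c) f ≡ ∑ ks (λ k → c k * ∑ (descentSets n k) f)
    ∑-tableaux c f = trans (∑-concatMap (λ k → concat (replicate (c k) (descentSets n k))) ks f)
                           (∑-cong ks (λ k → ∑-concat-replicate (c k) (descentSets n k) f))

    κ : ℕ → Subset n → ℕ
    κ k K = kostka (twoRow N k) (comp K)

    k∈ks⇒2k≤N : ∀ {k} → k < suc ⌊ N /2⌋ → k + k ≤ N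
    k∈ks⇒2k≤N {k} k<1+⌊N/2⌋ = ≤⌊/2⌋⇒+≤ N k (≤-pred k<1+⌊N/2⌋)

    κ≡K₂ : ∀ k K → k < suc ⌊ N /2⌋ → κ k K ≡ K₂ 0 k (comp K)
    κ≡K₂ k K k∈ks = kostka≡K₂ N k (comp K) (sum-compAux 1 K) (≤-trans (m≤m+n k k) (k∈ks⇒2k≤N k∈ks))

    #⊆-tableaux : ∀ c K → #⊆ (tableaux c) K ≡ ∑ ks (λ k → c k * κ k K)
    #⊆-tableaux c K = trans (∑-tableaux c _)
      (∑-upTo-cong (suc ⌊ N /2⌋) (λ k k∈ks → cong (c k *_) (trans (#⊆-descentSets k K) (sym (κ≡K₂ k K k∈ks)))))

    #⊇-tableaux-sparse : ∀ c J J′ → sparseᵇ J ≡ true → sparseᵇ J′ ≡ true → ∣ J ∣ ≡ ∣ J′ ∣ →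
      #⊇ (tableaux c) J ≡ #⊇ (tableaux c) J′
    #⊇-tableaux-sparse c J J′ J-sparse J′-sparse ∣J∣≡∣J′∣ = trans (∑-tableaux c _) (trans
      (∑-cong ks (λ k → cong (c k *_) (#⊇-descentSets-sparse n k J J′ J-sparse J′-sparse ∣J∣≡∣J′∣)))
      (sym (∑-tableaux c _)))

    mult-tableaux-nonsparse : ∀ c J → sparseᵇ J ≡ false → mult (tableaux c) J ≡ 0
    mult-tableaux-nonsparse c J J-not-sparse = trans (∑-tableaux c _)
      (∑-zero ks (λ k → trans (cong (c k *_) (mult-descentSets-nonsparse n k J J-not-sparse)) (*-zeroʳ (c k))))

    mult-tableaux-odds : ∀ c l → l + l ≤ N → mult (tableaux c) (odds n l) ≡ c l
    mult-tableaux-odds c l 2l≤N = begin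
      mult (tableaux c) (odds n l)                         ≡⟨ ∑-tableaux c _ ⟩
      ∑ ks (λ k → c k * mult (descentSets n k) (odds n l)) ≡⟨ ∑-cong ks (λ k → cong (c k *_) (mult-descentSets-odds n k l 2l≤N)) ⟩
      ∑ ks (λ k → c k * ⟦ k ≡ᵇ l ⟧)         ≡⟨ ∑-cong ks (λ k → *-comm (c k) _) ⟩
      ∑ ks (λ k → ⟦ k ≡ᵇ l ⟧ * c k)         ≡⟨ ∑-upTo-pick (suc ⌊ N /2⌋) l c (s≤s (+≤⇒≤⌊/2⌋ N l 2l≤N)) ⟩
      c l                                   ∎
      where open ≡-Reasoning

    count-via-𝒜 : ∀ (b : Subset n → Bool) {P : Fin m → Set} (P? : Decidable P) →
      (∀ a → does (P? a) ≡ b (D a)) → #[ P? ] ≡ ∑ 𝒜 (λ x → ⟦ b x ⟧)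
    count-via-𝒜 b P? P?≡b = trans (length-filter P? (allFin m))
      (trans (∑-cong (allFin m) (λ a → cong ⟦_⟧ (P?≡b a))) (sym (∑-map D (allFin m) _)))

    coefQ≡#⊆ : ∀ K → coefQ D K ≡ #⊆ 𝒜 K
    coefQ≡#⊆ K = count-via-𝒜 (_⊆ᵇ K) (λ a → D a ⊆? K) (λ a → ⊆?⇔⊆ᵇ (D a) K)

    #supersets≡#⊇ : ∀ J → #[ (λ a → J ⊆? D a) ] ≡ #⊇ 𝒜 J
    #supersets≡#⊇ J = count-via-𝒜 (J ⊆ᵇ_) (λ a → J ⊆? D a) (λ a → ⊆?⇔⊆ᵇ J (D a))

    oddCount≡mult : ∀ k → oddCount N m D k ≡ mult 𝒜 (odds n k)
    oddCount≡mult k = count-via-𝒜 (_== odds n k) (λ a → ≡-dec _≟B_ (D a) (odds n k)) (λ a → ≟⇔== (D a) (odds n k))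

    module NaturalExpansion (c : ℕ → ℕ) (expand : ∀ K → coefQ D K ≡ ∑ ks (λ k → c k * κ k K)) where

      twoRowExpansion : TwoRowExpansion N D (λ k → + c k)
      twoRowExpansion K = trans (cong +_ (expand K)) (sym (Σℤ-+ ks c (λ k → κ k K)))

      symmetric : Symmetric D
      symmetric K K′ comp↭ = trans (expand K) (trans (∑-upTo-cong (suc ⌊ N /2⌋) κ-invariant) (sym (expand K′)))
        where
        κ-invariant : ∀ k → k < suc ⌊ N /2⌋ → c k * κ k K ≡ c k * κ k K′
        κ-invariant k k∈ks = cong (c k *_) (begin
          κ k K            ≡⟨ κ≡K₂ k K k∈ks ⟩
          K₂ 0 k (comp K)  ≡⟨ K₂-↭ k comp↭ (subst (k + k ≤_) (sym (sum-compAux 1 K)) (k∈ks⇒2k≤N k∈ks)) ⟩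
          K₂ 0 k (comp K′) ≡⟨ κ≡K₂ k K′ k∈ks ⟨
          κ k K′           ∎)
          where open ≡-Reasoning

      schurCoefficient : List ℕ → ℕ
      schurCoefficient λs = ∑ ks (λ k → ⟦ λs ==ᴸ twoRow N k ⟧ * c k)

      schurExpansion : SchurExpansion N D (λ λs → + schurCoefficient λs)
      schurExpansion K = trans (cong +_ (sym regroup)) (sym (Σℤ-+ (partitions N) schurCoefficient (λ λs → kostka λs (comp K))))
        where
        open ≡-Reasoning
        P = partitions N
        only-twoRow : ∀ k λs → ⟦ λs ==ᴸ twoRow N k ⟧ * c k * kostka λs (comp K) ≡ ⟦ λs ==ᴸ twoRow N k ⟧ * (c k * κ k K)
        only-twoRow k λs with λs ==ᴸ twoRow N k in λs==
        ... | true rewrite ==ᴸ⇒≡ λs (twoRow N k) λs== = *-assoc 1 (c k) _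
        ... | false = refl
        regroup : ∑ P (λ λs → schurCoefficient λs * kostka λs (comp K)) ≡ coefQ D K
        regroup = begin
          ∑ P (λ λs → schurCoefficient λs * kostka λs (comp K))
            ≡⟨ ∑-cong P (λ λs → ∑-*ʳ ks (λ k → ⟦ λs ==ᴸ twoRow N k ⟧ * c k) (kostka λs (comp K))) ⟩
          ∑ P (λ λs → ∑ ks (λ k → ⟦ λs ==ᴸ twoRow N k ⟧ * c k * kostka λs (comp K)))
            ≡⟨ ∑-comm P ks _ ⟩
          ∑ ks (λ k → ∑ P (λ λs → ⟦ λs ==ᴸ twoRow N k ⟧ * c k * kostka λs (comp K)))
            ≡⟨ ∑-cong ks (λ k → trans (∑-cong P (only-twoRow k)) (sym (∑-*ʳ P _ (c k * κ k K)))) ⟩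
          ∑ ks (λ k → ∑ P (λ λs → ⟦ λs ==ᴸ twoRow N k ⟧) * (c k * κ k K))
            ≡⟨ ∑-upTo-cong (suc ⌊ N /2⌋) (λ k k∈ks → trans (cong (_* (c k * κ k K))
                 (#partitions-≡-twoRow N k (s≤s z≤n) (k∈ks⇒2k≤N k∈ks))) (+-identityʳ _)) ⟩
          ∑ ks (λ k → c k * κ k K)
            ≡⟨ expand K ⟨
          coefQ D K ∎

      schurPositive : SchurPositive N D
      schurPositive = symmetric , schurCoefficient , schurExpansion

    CondI⇒𝒜≈tableaux : CondI N m D → 𝒜 ≈ tableaux (oddCount N m D)
    CondI⇒𝒜≈tableaux (D-sparse , #⊇-by-size) = ≈-from-sparse-#⊇ 𝒜 (tableaux h) non-sparse sparse-shift witness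
      where
      h = oddCount N m D
      non-sparse : ∀ J → sparseᵇ J ≡ false → mult 𝒜 J ≡ mult (tableaux h) J
      non-sparse J J-not-sparse = trans (trans (∑-map D (allFin m) _) (∑-zero (allFin m) never)) (sym (mult-tableaux-nonsparse h J J-not-sparse))
        where
        never : ∀ a → ⟦ D a == J ⟧ ≡ 0
        never a with D a == J in Da==J
        ... | true with () ← trans (sym (Sparse⇒sparseᵇ (D a) (D-sparse a))) (trans (cong sparseᵇ (==⇒≡ (D a) J Da==J)) J-not-sparse)
        ... | false = refl
      sparse-shift : ∀ J J′ → sparseᵇ J ≡ true → sparseᵇ J′ ≡ true → ∣ J ∣ ≡ ∣ J′ ∣ →
        #⊇ 𝒜 J + #⊇ (tableaux h) J′ ≡ #⊇ 𝒜 J′ + #⊇ (tableaux h) J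
      sparse-shift J J′ J-sparse J′-sparse ∣J∣≡∣J′∣ = cong₂ _+_
        (trans (sym (#supersets≡#⊇ J))
          (trans (#⊇-by-size J J′ (sparseᵇ⇒Sparse J J-sparse) (sparseᵇ⇒Sparse J′ J′-sparse) ∣J∣≡∣J′∣) (#supersets≡#⊇ J′)))
        (#⊇-tableaux-sparse h J′ J J′-sparse J-sparse (sym ∣J∣≡∣J′∣))
      witness : ∀ J → sparseᵇ J ≡ true → Σ (Subset n) λ O → sparseᵇ O ≡ true × ∣ O ∣ ≡ ∣ J ∣ × mult 𝒜 O ≡ mult (tableaux h) O
      witness J J-sparse = odds n ∣ J ∣ , O-sparse , ∣O∣≡∣J∣ , trans (sym (oddCount≡mult ∣ J ∣)) (sym (mult-tableaux-odds h ∣ J ∣ 2∣J∣≤N))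
        where
        2∣J∣≤N = sparse⇒∣∣+∣∣≤ J J-sparse
        O-sparse = proj₁ (odds-sparse-∣∣ n ∣ J ∣ 2∣J∣≤N)
        ∣O∣≡∣J∣ = proj₂ (odds-sparse-∣∣ n ∣ J ∣ 2∣J∣≤N)

    CondI⇒expansion : CondI N m D → ∀ K → coefQ D K ≡ ∑ ks (λ k → oddCount N m D k * κ k K)
    CondI⇒expansion condI K = begin
      coefQ D K                          ≡⟨ coefQ≡#⊆ K ⟩
      #⊆ 𝒜 K                             ≡⟨ ≈⇒∑≡ 𝒜 (tableaux (oddCount N m D)) (CondI⇒𝒜≈tableaux condI) _ ⟩
      #⊆ (tableaux (oddCount N m D)) K   ≡⟨ #⊆-tableaux (oddCount N m D) K ⟩
      ∑ ks (λ k → oddCount N m D k * κ k K) ∎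
      where open ≡-Reasoning

    -- With c = c⁺ − c⁻, the expansion says 𝒜 ⊎ tableaux c⁻ and tableaux c⁺ have the same
    -- subset counts, hence are the same multiset of sparse sets.
    module IntegerExpansion (c : ℕ → ℤ) (expand : TwoRowExpansion N D c) where

      𝒜⁻≈⁺ : 𝒜 ++ tableaux (λ k → c k ⁻) ≈ tableaux (λ k → c k ⁺)
      𝒜⁻≈⁺ = ≈-from-#⊆ (𝒜 ++ tableaux (λ k → c k ⁻)) (tableaux (λ k → c k ⁺)) λ K → begin
        #⊆ (𝒜 ++ tableaux (λ k → c k ⁻)) K                 ≡⟨ ∑-++ 𝒜 _ _ ⟩
        #⊆ 𝒜 K + #⊆ (tableaux (λ k → c k ⁻)) K             ≡⟨ cong₂ _+_ (sym (coefQ≡#⊆ K)) (#⊆-tableaux (λ k → c k ⁻) K) ⟩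
        coefQ D K + ∑ ks (λ k → c k ⁻ * κ k K)             ≡⟨ +-≡-− _ _ _ (trans (expand K) (Σℤ-split ks c (λ k → κ k K))) ⟩
        ∑ ks (λ k → c k ⁺ * κ k K)                         ≡⟨ #⊆-tableaux (λ k → c k ⁺) K ⟨
        #⊆ (tableaux (λ k → c k ⁺)) K                      ∎
        where open ≡-Reasoning

      sparse : SparseStat D
      sparse a = sparseᵇ⇒Sparse (D a) (by-sparseness (sparseᵇ (D a)) refl)
        where
        by-sparseness : ∀ b → sparseᵇ (D a) ≡ b → sparseᵇ (D a) ≡ true
        by-sparseness true Da-sparse = Da-sparse
        by-sparseness false Da-not-sparse =
          contradiction Da∈ (≤⇒≯ (≤-reflexive (trans (𝒜⁻≈⁺ (D a)) (mult-tableaux-nonsparse (λ k → c k ⁺) (D a) Da-not-sparse))))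
          where
          Da∈ : 0 < mult (𝒜 ++ tableaux (λ k → c k ⁻)) (D a)
          Da∈ = ≤-trans (≤-reflexive (cong ⟦_⟧ (sym (==-refl (D a)))))
                  (≤-trans (∑-≥ (λ b → ⟦ D b == D a ⟧) (∈-allFin a))
                    (≤-trans (≤-reflexive (sym (∑-map D (allFin m) _)))
                      (≤-trans (m≤m+n _ _) (≤-reflexive (sym (∑-++ 𝒜 _ _))))))

      #⊇-by-size : ∀ J J′ → Sparse J → Sparse J′ → ∣ J ∣ ≡ ∣ J′ ∣ → #[ (λ a → J ⊆? D a) ] ≡ #[ (λ a → J′ ⊆? D a) ]
      #⊇-by-size J J′ J-sparse J′-sparse ∣J∣≡∣J′∣ = begin
        #[ (λ a → J ⊆? D a) ]  ≡⟨ #supersets≡#⊇ J ⟩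
        #⊇ 𝒜 J                 ≡⟨ +-cancelʳ-≡ (#⊇ (tableaux (λ k → c k ⁻)) J) _ _ shift ⟩
        #⊇ 𝒜 J′                ≡⟨ #supersets≡#⊇ J′ ⟨
        #[ (λ a → J′ ⊆? D a) ] ∎
        where
        open ≡-Reasoning
        J-sp = Sparse⇒sparseᵇ J J-sparse
        J′-sp = Sparse⇒sparseᵇ J′ J′-sparse
        #⊇-split : ∀ J → #⊇ 𝒜 J + #⊇ (tableaux (λ k → c k ⁻)) J ≡ #⊇ (tableaux (λ k → c k ⁺)) J
        #⊇-split J = trans (sym (∑-++ 𝒜 _ _))
          (≈⇒∑≡ (𝒜 ++ tableaux (λ k → c k ⁻)) (tableaux (λ k → c k ⁺)) 𝒜⁻≈⁺ (λ x → ⟦ J ⊆ᵇ x ⟧))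
        shift : #⊇ 𝒜 J + #⊇ (tableaux (λ k → c k ⁻)) J ≡ #⊇ 𝒜 J′ + #⊇ (tableaux (λ k → c k ⁻)) J
        shift = begin
          #⊇ 𝒜 J + #⊇ (tableaux (λ k → c k ⁻)) J   ≡⟨ #⊇-split J ⟩
          #⊇ (tableaux (λ k → c k ⁺)) J            ≡⟨ #⊇-tableaux-sparse (λ k → c k ⁺) J J′ J-sp J′-sp ∣J∣≡∣J′∣ ⟩
          #⊇ (tableaux (λ k → c k ⁺)) J′           ≡⟨ #⊇-split J′ ⟨
          #⊇ 𝒜 J′ + #⊇ (tableaux (λ k → c k ⁻)) J′
            ≡⟨ cong (λ z → #⊇ 𝒜 J′ + z) (#⊇-tableaux-sparse (λ k → c k ⁻) J′ J J′-sp J-sp (sym ∣J∣≡∣J′∣)) ⟩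
          #⊇ 𝒜 J′ + #⊇ (tableaux (λ k → c k ⁻)) J  ∎

    CondII⇒CondI : CondII N m D → CondI N m D
    CondII⇒CondI (_ , c , expand) = sparse , #⊇-by-size
      where open IntegerExpansion c expand

    CondI⇒CondII : CondI N m D → CondII N m D
    CondI⇒CondII condI = symmetric , (λ k → + oddCount N m D k) , twoRowExpansion
      where open NaturalExpansion (oddCount N m D) (CondI⇒expansion condI)

    CondI⇒positiveExpansion : CondI N m D → SchurPositive N D × TwoRowExpansion N D (λ k → + oddCount N m D k)
    CondI⇒positiveExpansion condI = schurPositive , twoRowExpansion
      where open NaturalExpansion (oddCount N m D) (CondI⇒expansion condI)


open import Defs
open import Data.Nat using (ℕ; suc; _≤_; _∸_)
open import Data.Fin using (Fin)
open import Data.Fin.Subset using (Subset)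
open import Data.Product using (_×_; _,_)
open import Data.Integer using (+_)
open import Function.Bundles using (_⇔_; mk⇔)
open Expansion

theorem1p8 : (N : ℕ) → 1 ≤ N → (m : ℕ) → (D : Fin m → Subset (N ∸ 1)) →
    (CondI N m D ⇔ CondII N m D) ×
    (CondI N m D → SchurPositive N D × TwoRowExpansion N D (λ k → + oddCount N m D k))
theorem1p8 (suc n) _ m D = mk⇔ (CondI⇒CondII n m D) (CondII⇒CondI n m D) , CondI⇒positiveExpansion n m D
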